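{- Let $\pi$ be a quasigraph in a $3$-hypergraph $H$ (with a fixed linear order $\leq_E$ on $E(H)$). Let $e$ be a hyperedge of $H$ used by $\pi$ and $X\subseteq V(H)$ such that $\pi(e)\subseteq X$, $\pi-e$ is connected on $X$, and one of the following holds: (a) the two vertices of $\pi(e)$ lie in different classes of $\mathcal P^\pi_{i,j}$ for some $0\le i,j<\infty$ with $(i,j)\neq(0,0)$, and $X$ is a class of the predecessor of $\mathcal P^\pi_{i,j}$; or (b) $X\in\mathcal P^\pi_{\infty,\infty}$ and $\mathcal P^\pi_{\infty,\infty}$ is $\pi$-skeletal. Then $\pi-e\sqsupseteq\pi$. Moreover, if (a) holds, then $\pi-e\sqsupset\pi$.
   Context: The predecessor of $\mathcal P^\pi_{i,j}$ (for finite $i,j$, $(i,j)\neq(0,0)$) is $\mathcal P^\pi_{i,j-1}$ if $j>0$ and $\mathcal P^\pi_{i-1,\infty}$ if $j=0$. A partition $\mathcal P$ of $V(H)$ is $\pi$-skeletal if it is $\pi$-solid and $\overline{\pi/\mathcal P}$ is acyclic (has no quasicycle). A $3$-hypergraph $H$ is a finite hypergraph (multiple hyperedges allowed) all of whose hyperedges have size $2$ or $3$. A quasigraph $\pi$ in $H$ assigns to each hyperedge $e$ either a $2$-subset of $e$ or $\emptyset$; $e$ is used if $\pi(e)\ne\emptyset$. $\pi^*$ is the multigraph on $V(H)$ with an edge $\pi(e)$ for each used $e$. $\pi$ is a quasicycle if $\pi^*$ is one cycle plus isolated vertices. $\pi-e$ has value $\emptyset$ on $e$ and equals $\pi$ elsewhere.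 For a partition $\mathcal P$ of $V(H)$, a hyperedge (or pair) is $\mathcal P$-crossing if it meets at least two classes; $e/\mathcal P$ is the set of classes met by $e$. $H/\mathcal P$ is the $3$-hypergraph on vertex set $\mathcal P$ with one hyperedge $e/\mathcal P$ for each $\mathcal P$-crossing hyperedge $e$ of $H$; $\pi/\mathcal P$ is the quasigraph in it with $(\pi/\mathcal P)(e/\mathcal P)=\pi(e)/\mathcal P$ if $\pi(e)$ is $\mathcal P$-crossing and $\emptyset$ otherwise. $\overline{\pi/\mathcal P}$ is the subhypergraph of $H/\mathcal P$ of hyperedges not used by $\pi/\mathcal P$. For $X\subseteq V(H)$: $\pi$ is connected on $X$ if $\pi^*[X]$ is connected; components of $\pi$ on $X$ are vertex sets of components of $\pi^*[X]$. $\pi$ is anticonnected on $X$ (in $H$) if for every partition $\mathcal R$ of $X$ with $\ge2$ classes some hyperedge $f$ of $H$ meets $\ge2$ classes of $\mathcal R$ while $\pi(f)$ lies in one class (possibly $\pi(f)=\emptyset$); the maximal subsets of $X$ on which $\pi$ is anticonnected partition $X$ and are the anticomponents of $\pi$ on $X$. A partition is $\pi$-solid if $\pi$ is connected and anticonnected on each class. If $\pi$ is connected and anticonnected on $X$ and $|e\cap X|=2$: $e$ is an $X$-bridge if $e$ is used, $\pi(e)\subseteq X$ and $\pi-e$ is not connected on $X$; $e$ is an $X$-antibridge if $e$ is unused and $\pi$ is not anticonnected on $X$ in $H-e$. For a $\pi$-solid $\mathcal R$, $e$ is an $\mathcal R$-(anti)bridge if it is an $X$-(anti)bridge for some $X\in\mathcal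 R$. A $\mathcal R$-crossing hyperedge is redundant if it is unused and not an $\mathcal R$-antibridge; weakly redundant if it is redundant, or used and not an $\mathcal R$-bridge. Plane sequence: $\mathbb T=\{(i,j):0\le i<\infty,0\le j\le\infty\}\cup\{(\infty,\infty)\}$, ordered lexicographically. Set $\mathcal P_{0,0}=\{V(H)\}$. For $1\le j<\infty$, $\mathcal P_{i,j}$ consists of the components (if $j$ odd) or anticomponents (if $j$ even) of $\pi$ on the classes of $\mathcal P_{i,j-1}$; $\mathcal P_{i,\infty}$ is the eventual constant value of $\mathcal P_{i,j}$. For $i\ge1$ let $\mathcal P=\mathcal P_{i-1,\infty}$. The exposure step of two distinct classes $A,B$ of $\mathcal P$ is the least $(s,t)\in\mathbb T$ with $A,B$ in different classes of $\mathcal P_{s,t}$; the exposure step of a quasicycle $\gamma$ in $\overline{\pi/\mathcal P}$ is the least exposure step of $\gamma(e/\mathcal P)$ over hyperedges $e$ with $e/\mathcal P$ used by $\gamma$; such $e$ is a leading hyperedge of $\gamma$ if the exposure step of $\gamma(e/\mathcal P)$ equals that of $\gamma$. If $\overline{\pi/\mathcal P}$ has no quasicycle: $\mathcal P_{i,0}=\mathcal P$, $d_{i-1}=\mathrm{TERMINATE}$. Otherwise let $L$ be the set of hyperedges of $H$ that are leading hyperedges of some quasicycle in $\overline{\pi/\mathcal P}$; if $L$ contains a hyperedge weakly redundant w.r.t. $\pi,\mathcal P$: $\mathcal P_{i,0}=\mathcal P$, $d_{i-1}=\mathrm{STOP}$. Otherwise let $e$ be the $\leq_E$-maximum of $L$,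 $d_{i-1}=e$; if $e$ is a $\mathcal P$-antibridge, $\mathcal P_{i,0}$ consists of the anticomponents of $\pi$ in $H-e$ on the classes of $\mathcal P$; if $e$ is a $\mathcal P$-bridge, of the components of $\pi-e$ on the classes of $\mathcal P$. $\mathcal P_{\infty,\infty}$ is the eventual constant value of $\mathcal P_{i,\infty}$. We write $\mathcal P^\pi_{i,j}$, $d^\pi_i$. Signature: $\mathrm{sig}(\pi)=(\mathcal P_{0,0},\mathcal P_{0,1},\dots,\mathcal P_{0,\infty},d_0,\mathcal P_{1,0},\dots,\mathcal P_{1,\infty},d_1,\dots,\mathcal P_{\ell,\infty},d_\ell)$ with $\ell$ least such that $d_\ell\in\{\mathrm{TERMINATE},\mathrm{STOP}\}$. Partitions are compared by refinement ($\mathcal P\le\mathcal P'$ iff every class of $\mathcal P$ lies in a class of $\mathcal P'$); the values $d$ are compared by a fixed linear order on $E(H)\cup\{\mathrm{STOP},\mathrm{TERMINATE}\}$ extending $\leq_E$ in which STOP exceeds every hyperedge. $\mathrm{sig}(\pi)\le\mathrm{sig}(\rho)$ lexicographically if they are equal or at the first differing position the entry for $\pi$ is strictly smaller. $\pi\sqsubseteq\rho$ iff $\mathrm{sig}(\pi)\le\mathrm{sig}(\rho)$; $\rho\sqsupseteq\pi$ means $\pi\sqsubseteq\rho$; $\pi\equiv\rho$ iff both $\pi\sqsubseteq\rho$ and $\rho\sqsubseteq\pi$; $\rho\sqsupset\pi$ iff $\pi\sqsubseteq\rho$ and $\pi\not\equiv\rho$. -}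

module Defs where

open import Data.Nat as ℕ using (ℕ; zero; suc; _≤?_)
open import Data.Fin as Fin using (Fin; toℕ; fromℕ<)
open import Data.Fin.Subset using (Subset; _∈_; _⊆_; ∣_∣; Nonempty) renaming (⊥ to ∅)
open import Data.Product using (Σ; ∃; ∃-syntax; _×_; _,_)
open import Data.Sum using (_⊎_)
open import Data.Empty renaming (⊥ to Empty)
open import Data.Unit using (⊤)
open import Relation.Nullary using (¬_; yes; no)
open import Relation.Binary.PropositionalEquality using (_≡_; _≢_)

-- 3-hypergraphs and quasigraphs
-- A 3-hypergraph on vertex set Fin n with m hyperedges (multiple
-- hyperedges allowed): E a is the vertex set of hyperedge a.
-- The fixed linear order ≤_E on E(H) is the index order on Fin m.

Is3Hyp : ∀ {n m} → (Fin m → Subset n) → Set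
Is3Hyp E = ∀ a → (∣ E a ∣ ≡ 2) ⊎ (∣ E a ∣ ≡ 3)

QG : ℕ → ℕ → Set
QG n m = Fin m → Subset n

IsQuasigraph : ∀ {n m} → (Fin m → Subset n) → QG n m → Set
IsQuasigraph E π = ∀ a → (π a ⊆ E a) × ((∣ π a ∣ ≡ 2) ⊎ (π a ≡ ∅))

Used : ∀ {n m} → QG n m → Fin m → Set
Used π a = Nonempty (π a)

_⊖_ : ∀ {n m} → QG n m → Fin m → QG n m
(π ⊖ e) f with e Fin.≟ f
... | yes _ = ∅
... | no _ = π f

-- vertex sets as predicates, partitions as (equivalence) relations

VSet : ℕ → Set₁
VSet n = Fin n → Set

Part : ℕ → Set₁
Part n = Fin n → Fin n → Set

_≤P_ : ∀ {n} → Part n → Part n → Set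
P ≤P Q = ∀ x y → P x y → Q x y

_≈P_ : ∀ {n} → Part n → Part n → Set
P ≈P Q = (P ≤P Q) × (Q ≤P P)

Full : ∀ {n} → Part n
Full _ _ = ⊤

IsClass : ∀ {n} → Part n → Subset n → Set
IsClass P X = ∃[ x ] (x ∈ X × (∀ y → ((y ∈ X → P x y) × (P x y → y ∈ X))))

data Reach {n m} (π : QG n m) (X : VSet n) (x : Fin n) : Fin n → Set where
  here : X x → Reach π X x x
  step : ∀ {y z} a → Reach π X x y → y ∈ π a → z ∈ π a → X z → Reach π X x z

ConnOn : ∀ {n m} → QG n m → VSet n → Set
ConnOn π X = ∀ x y → X x → X y → Reach π X x y

CompRef : ∀ {n m} → QG n m → Part n → Part n
CompRef π P x y = P x y × Reach π (P x) x y

-- anticonnectivity, in the subhypergraph of H with hyperedges satisfying keep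
-- (keep = λ _ → ⊤ for H itself, keep = (_≢ e) for H - e).
-- A partition R of X (with ≥ 2 classes) is given by a labelling c,
-- the classes being the nonempty fibres of c restricted to X.

AntiConn : ∀ {n m} → (Fin m → Subset n) → (Fin m → Set) → QG n m → VSet n → Set
AntiConn {n} E keep π X =
  (c : Fin n → Fin n) →
  (∃[ x ] ∃[ y ] (X x × X y × c x ≢ c y)) →
  ∃[ f ] (keep f
         × (∃[ x ] ∃[ y ] (x ∈ E f × y ∈ E f × X x × X y × c x ≢ c y))
         × (∀ x y → x ∈ π f → y ∈ π f → X x × X y × c x ≡ c y))

AllE : ∀ {m} → Fin m → Set
AllE _ = ⊤

SameAnti : ∀ {n m} → (Fin m → Subset n) → (Fin m → Set) → QG n m → VSet n →
           Fin n → Fin n → Set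
SameAnti E keep π X x y =
  ∃[ Y ] ((∀ z → z ∈ Y → X z) × AntiConn E keep π (_∈ Y) × x ∈ Y × y ∈ Y
         × (∀ Z → Y ⊆ Z → (∀ z → z ∈ Z → X z) → AntiConn E keep π (_∈ Z) → Z ⊆ Y))

AntiRef : ∀ {n m} → (Fin m → Subset n) → (Fin m → Set) → QG n m → Part n → Part n
AntiRef E keep π P x y = P x y × SameAnti E keep π (P x) x y

Solid : ∀ {n m} → (Fin m → Subset n) → QG n m → Part n → Set
Solid E π P = ∀ x → ConnOn π (P x) × AntiConn E AllE π (P x)

Inter2 : ∀ {n} → Subset n → VSet n → Set
Inter2 e X = ∃[ u ] ∃[ v ] (u ≢ v × u ∈ e × v ∈ e × X u × X v
              × (∀ w → w ∈ e → X w → (w ≡ u) ⊎ (w ≡ v)))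

XBridge : ∀ {n m} → (Fin m → Subset n) → QG n m → Fin m → VSet n → Set
XBridge E π a X = ConnOn π X × AntiConn E AllE π X × Inter2 (E a) X
  × Used π a × (∀ x → x ∈ π a → X x) × ¬ ConnOn (π ⊖ a) X

XAntibridge : ∀ {n m} → (Fin m → Subset n) → QG n m → Fin m → VSet n → Set
XAntibridge E π a X = ConnOn π X × AntiConn E AllE π X × Inter2 (E a) X
  × ¬ Used π a × ¬ AntiConn E (λ f → f ≢ a) π X

PBridge : ∀ {n m} → (Fin m → Subset n) → QG n m → Part n → Fin m → Set
PBridge E π P a = ∃[ w ] XBridge E π a (P w)

PAntibridge : ∀ {n m} → (Fin m → Subset n) → QG n m → Part n → Fin m → Set
PAntibridge E π P a = ∃[ w ] XAntibridge E π a (P w)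

Crossing : ∀ {n} → Part n → Subset n → Set
Crossing P e = ∃[ x ] ∃[ y ] (x ∈ e × y ∈ e × ¬ P x y)

Redundant : ∀ {n m} → (Fin m → Subset n) → QG n m → Part n → Fin m → Set
Redundant E π P a = Crossing P (E a) × ¬ Used π a × ¬ PAntibridge E π P a

WeaklyRedundant : ∀ {n m} → (Fin m → Subset n) → QG n m → Part n → Fin m → Set
WeaklyRedundant E π P a =
  Redundant E π P a ⊎ (Crossing P (E a) × Used π a × ¬ PBridge E π P a)

-- quasicycles in the hypergraph of hyperedges of H/P not used by π/P.
-- Hyperedges of H/P are indexed by the P-crossing hyperedges of H;
-- classes of P are given by representatives.  A quasicycle γ is given
-- by its cycle: k+2 pairwise distinct hyperedges edg t and pairwise
-- distinct classes rep t with γ(edg t / P) = {class (rep t), class (rep (t+1))},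
-- γ being ∅ on all other hyperedges.

next : ∀ {k} → Fin (suc k) → Fin (suc k)
next {k} t with suc (toℕ t) ≤? k
... | yes p = fromℕ< (ℕ.s≤s p)
... | no _ = Fin.zero

record QCyc {n m} (E : Fin m → Subset n) (π : QG n m) (P : Part n) : Set where
  field
    k : ℕ
    edg : Fin (suc (suc k)) → Fin m
    edg-inj : ∀ s t → edg s ≡ edg t → s ≡ t
    rep : Fin (suc (suc k)) → Fin n
    rep-distinct : ∀ s t → P (rep s) (rep t) → s ≡ t
    meets : ∀ t → (∃[ u ] (u ∈ E (edg t) × P (rep t) u))
                × (∃[ v ] (v ∈ E (edg t) × P (rep (next t)) v))
    unused : ∀ t → ¬ Crossing P (π (edg t))

data D (m : ℕ) : Set where
  edge : Fin m → D m
  STOP : D m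
  TERMINATE : D m

Terminal : ∀ {m} → D m → Set
Terminal d = (d ≡ STOP) ⊎ (d ≡ TERMINATE)

-- a linear order on E(H) ∪ {STOP, TERMINATE}, given by an injective rank,
-- extending ≤_E, with STOP above every hyperedge
DOrder : ∀ {m} → (D m → ℕ) → Set
DOrder {m} rank = (∀ x y → rank x ≡ rank y → x ≡ y)
  × (∀ (a b : Fin m) → a Fin.< b → rank (edge a) ℕ.< rank (edge b))
  × (∀ a → rank (edge a) ℕ.< rank STOP)

record Seq (n m : ℕ) : Set₁ where
  field
    P : ℕ → ℕ → Part n
    Pinf : ℕ → Part n         -- Pinf i = 𝒫_{i,∞}
    Pii : Part n              -- 𝒫_{∞,∞}
    d : ℕ → D m
open Seq public

data T : Set where
  fin : ℕ → ℕ → T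
  inf : ℕ → T
  infinf : T

data _<T_ : T → T → Set where
  ff1 : ∀ {i j i' j'} → i ℕ.< i' → fin i j <T fin i' j'
  ff2 : ∀ {i j j'} → j ℕ.< j' → fin i j <T fin i j'
  fi : ∀ {i j i'} → i ℕ.≤ i' → fin i j <T inf i'
  if : ∀ {i i' j'} → i ℕ.< i' → inf i <T fin i' j'
  ii : ∀ {i i'} → i ℕ.< i' → inf i <T inf i'
  f∞ : ∀ {i j} → fin i j <T infinf
  i∞ : ∀ {i} → inf i <T infinf

_≤T_ : T → T → Set
p ≤T q = (p <T q) ⊎ (p ≡ q)

At : ∀ {n m} → Seq n m → T → Part n
At S (fin i j) = P S i j
At S (inf i) = Pinf S i
At S infinf = Pii S

ExpStep : ∀ {n m} → Seq n m → Fin n → Fin n → T → Set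
ExpStep S x y p = ¬ At S p x y × (∀ q → q <T p → At S q x y)

Leading : ∀ {n m} {E : Fin m → Subset n} {π : QG n m} {P : Part n} →
          Seq n m → (γ : QCyc E π P) → Fin (suc (suc (QCyc.k γ))) → Set
Leading S γ t = ∃[ p ] (ExpStep S (rep t) (rep (next t)) p
    × (∀ r q → ExpStep S (rep r) (rep (next r)) q → p ≤T q))
  where open QCyc γ

InL : ∀ {n m} → (Fin m → Subset n) → QG n m → Seq n m → Part n → Fin m → Set
InL E π S P a = ∃[ γ ] ∃[ t ] (QCyc.edg {E = E} {π} {P} γ t ≡ a × Leading S γ t)

Round : ∀ {n m} → (Fin m → Subset n) → QG n m → Seq n m → ℕ → Set
Round E π S i =
    (¬ QCyc E π Pp × (P' ≈P Pp) × (di ≡ TERMINATE))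
  ⊎ (QCyc E π Pp × (∃[ a ] (InL E π S Pp a × WeaklyRedundant E π Pp a))
       × (P' ≈P Pp) × (di ≡ STOP))
  ⊎ (QCyc E π Pp × ¬ (∃[ a ] (InL E π S Pp a × WeaklyRedundant E π Pp a))
       × ∃[ a ] ((InL E π S Pp a × (∀ b → InL E π S Pp b → b Fin.≤ a))
       × (di ≡ edge a)
       × ((PAntibridge E π Pp a × (P' ≈P AntiRef E (λ f → f ≢ a) π Pp))
         ⊎ (PBridge E π Pp a × (P' ≈P CompRef (π ⊖ a) Pp)))))
  where
    Pp = Pinf S i
    P' = P S (suc i) 0
    di = d S i

odd : ℕ → Set
odd zero = Empty
odd (suc zero) = ⊤
odd (suc (suc k)) = odd k

Refine : ∀ {n m} → (Fin m → Subset n) → QG n m → ℕ → Part n → Part n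
Refine E π zero Q = CompRef π Q
Refine E π (suc zero) Q = AntiRef E AllE π Q
Refine E π (suc (suc j)) Q = Refine E π j Q

-- S is the plane sequence of π (partitions determined up to ≈P)
PlaneSeq : ∀ {n m} → (Fin m → Subset n) → QG n m → Seq n m → Set
PlaneSeq E π S =
    (P S 0 0 ≈P Full)
  × (∀ i j → P S i (suc j) ≈P Refine E π j (P S i j))
  × (∀ i → ∃[ N ] (∀ j → N ℕ.≤ j → P S i j ≈P Pinf S i))
  × (∃[ N ] (∀ i → N ℕ.≤ i → Pinf S i ≈P Pii S))
  × (∀ i → Round E π S i)

data Tag : Set where
  pj : ℕ → Tag
  p∞ : Tag
  dd : Tag

data _<Pos_ : ℕ × Tag → ℕ × Tag → Set where
  lt-i : ∀ {i i' s s'} → i ℕ.< i' → (i , s) <Pos (i' , s')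
  lt-jj : ∀ {i j j'} → j ℕ.< j' → (i , pj j) <Pos (i , pj j')
  lt-j∞ : ∀ {i j} → (i , pj j) <Pos (i , p∞)
  lt-jd : ∀ {i j} → (i , pj j) <Pos (i , dd)
  lt-∞d : ∀ {i} → (i , p∞) <Pos (i , dd)

-- round i belongs to the signature (no earlier d is terminal)
InSig : ∀ {n m} → Seq n m → ℕ → Set
InSig S i = ∀ k → k ℕ.< i → ¬ Terminal (d S k)

EqAt : ∀ {n m} → Seq n m → Seq n m → ℕ × Tag → Set
EqAt S S' (i , pj j) = P S i j ≈P P S' i j
EqAt S S' (i , p∞) = Pinf S i ≈P Pinf S' i
EqAt S S' (i , dd) = d S i ≡ d S' i

LtAt : ∀ {n m} → (D m → ℕ) → Seq n m → Seq n m → ℕ × Tag → Set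
LtAt rank S S' (i , pj j) = (P S i j ≤P P S' i j) × ¬ (P S i j ≈P P S' i j)
LtAt rank S S' (i , p∞) = (Pinf S i ≤P Pinf S' i) × ¬ (Pinf S i ≈P Pinf S' i)
LtAt rank S S' (i , dd) = rank (d S i) ℕ.< rank (d S' i)

SigLe : ∀ {n m} → (D m → ℕ) → Seq n m → Seq n m → Set
SigLe rank S S' =
    (∀ p → InSig S (Data.Product.proj₁ p) → EqAt S S' p)
  ⊎ (∃[ p ] (InSig S (Data.Product.proj₁ p) × InSig S' (Data.Product.proj₁ p)
            × (∀ q → q <Pos p → EqAt S S' q) × LtAt rank S S' p))

SigLt : ∀ {n m} → (D m → ℕ) → Seq n m → Seq n m → Set
SigLt rank S S' = SigLe rank S S' × ¬ SigLe rank S' S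

CondA : ∀ {n m} → QG n m → Seq n m → Fin m → Subset n → Set
CondA π S e X =
    (∃[ i ] ∃[ j ] (∃[ u ] ∃[ v ] (u ∈ π e × v ∈ π e × ¬ P S i (suc j) u v)
                    × IsClass (P S i j) X))
  ⊎ (∃[ i ] (∃[ u ] ∃[ v ] (u ∈ π e × v ∈ π e × ¬ P S (suc i) 0 u v)
                    × IsClass (Pinf S i) X))

Skeletal : ∀ {n m} → (Fin m → Subset n) → QG n m → Part n → Set
Skeletal E π P = Solid E π P × ¬ QCyc E π P

CondB : ∀ {n m} → (Fin m → Subset n) → QG n m → Seq n m → Subset n → Set
CondB E π S X = IsClass (Pii S) X × Skeletal E π (Pii S)

-- Write σ = π - e. While X lies inside a class of the current partition of the plane
-- sequence of π, the plane sequence of σ agrees with it or first differs by being coarser: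
-- components agree because π(e) ⊆ X and σ is connected on X, anticomponents of σ are at
-- least as coarse because σ uses fewer hyperedges, and once the partitions agree, π and σ
-- see the same quasicycles and leading hyperedges and cut along them alike. So the first
-- entry where the signatures differ is larger for σ, giving π ⊑ σ; under (b) X stays inside
-- a class of every partition of the signature. Under (a), at the step splitting the two ends
-- of π(e), σ keeps them together (they are connected in σ, and the unused e cannot separate
-- them into different anticomponents), so σ is strictly coarser there and π ⊏ σ.

module Submission where

open import Defs
open import Data.Nat as ℕ using (ℕ; zero; suc; _+_; z≤n; s≤s; _≤′_; ≤′-refl; ≤′-step)
import Data.Nat.Properties as ℕP
open import Data.Fin as Fin using (Fin; toℕ)
import Data.Fin.Properties as FinP
open import Data.Fin.Subset using (Subset; _∈_; _⊆_; ∣_∣; inside; outside; ⁅_⁆; _∪_)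
import Data.Fin.Subset.Properties as SubP
open import Data.Vec using (tabulate)
open import Data.Vec.Functional using (_∷_; head; tail)
import Data.Vec.Properties as VecP
open import Data.Product using (Σ; ∃-syntax; _×_; _,_; proj₁; proj₂)
open import Data.Sum using (_⊎_; inj₁; inj₂; [_,_]′; reduce)
import Data.Sum.Effectful.Left
open import Effect.Monad using (RawMonad)
open import Level using (0ℓ)
open import Data.Empty using (⊥-elim) renaming (⊥ to Empty)
open import Data.Unit using (tt)
open import Data.Bool using (if_then_else_)
open import Function using (_∘_; case_of_)
open import Relation.Nullary using (¬_; Dec; yes; no; does)
open import Relation.Nullary.Decidable using (map′; _×-dec_; _⊎-dec_; _→-dec_; ¬?)
open import Relation.Binary.PropositionalEquality using (_≡_; _≢_; refl; sym; trans; cong; subst; subst₂)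
open import Relation.Binary.Definitions using (tri<; tri≈; tri>)
open import Relation.Binary.Structures using (IsEquivalence; IsDecEquivalence; IsPreorder)
open import Relation.Binary.Bundles using (Preorder)
import Relation.Binary.Reasoning.Preorder

module _ {n m} (ρ : QG n m) (e : Fin m) where

  ∈-⊖⁻ : ∀ a {z} → z ∈ (ρ ⊖ e) a → z ∈ ρ a
  ∈-⊖⁻ a z∈ with e Fin.≟ a
  ... | yes _ = ⊥-elim (SubP.∉⊥ z∈)
  ... | no _ = z∈

  ∈-⊖⇒≢ : ∀ a {z} → z ∈ (ρ ⊖ e) a → e ≢ a
  ∈-⊖⇒≢ a z∈ with e Fin.≟ a
  ... | yes _ = ⊥-elim (SubP.∉⊥ z∈)
  ... | no e≢a = e≢a

  ∈-⊖⁺ : ∀ a {z} → e ≢ a → z ∈ ρ a → z ∈ (ρ ⊖ e) a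
  ∈-⊖⁺ a e≢a z∈ with e Fin.≟ a
  ... | yes e≡a = ⊥-elim (e≢a e≡a)
  ... | no _ = z∈

fromDec : ∀ {n} {Q : Fin n → Set} → (∀ z → Dec (Q z)) → Subset n
fromDec Q? = tabulate (λ z → if does (Q? z) then inside else outside)

module _ {n} {Q : Fin n → Set} (Q? : ∀ z → Dec (Q z)) where

  ∈-fromDec⁻ : ∀ z → z ∈ fromDec Q? → Q z
  ∈-fromDec⁻ z z∈ = decided (Q? z) (trans (sym (VecP.lookup∘tabulate _ z)) (VecP.[]=⇒lookup z∈))
    where
      decided : (d : Dec (Q z)) → (if does d then inside else outside) ≡ inside → Q z
      decided (yes q) _ = q
      decided (no _) ()

  ∈-fromDec⁺ : ∀ z → Q z → z ∈ fromDec Q?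
  ∈-fromDec⁺ z q = VecP.lookup⇒[]= z _ (trans (VecP.lookup∘tabulate _ z) (decided (Q? z)))
    where
      decided : (d : Dec (Q z)) → (if does d then inside else outside) ≡ inside
      decided (yes _) = refl
      decided (no ¬q) = ⊥-elim (¬q q)

all-subsets? : ∀ {n} {Q : Subset n → Set} → (∀ Z → Dec (Q Z)) → Dec (∀ Z → Q Z)
all-subsets? {Q = Q} Q? with SubP.anySubset? (λ Z → ¬? (Q? Z))
... | yes (Z , ¬q) = no λ q → ¬q (q Z)
... | no ∄¬q = yes λ Z → holds Z (Q? Z)
  where
    holds : ∀ Z → Dec (Q Z) → Q Z
    holds Z (yes q) = q
    holds Z (no ¬q) = ⊥-elim (∄¬q (Z , ¬q))

∣p∣≡2⇒≡⊎≡ : ∀ {n} {p : Subset n} {x y z} → ∣ p ∣ ≡ 2 → x ∈ p → y ∈ p → x ≢ y → z ∈ p →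
            (z ≡ x) ⊎ (z ≡ y)
∣p∣≡2⇒≡⊎≡ {p = p} {x} {y} {z} ∣p∣≡2 x∈p y∈p x≢y z∈p with z Fin.≟ x | z Fin.≟ y
... | yes z≡x | _ = inj₁ z≡x
... | no _ | yes z≡y = inj₂ z≡y
... | no z≢x | no z≢y = ⊥-elim (ℕP.<-irrefl (sym ∣p∣≡2) 2<∣p∣)
  where
    2<∣p∣ : 2 ℕ.< ∣ p ∣
    2<∣p∣ = ℕP.<-≤-trans (s≤s (ℕP.<-≤-trans (s≤s (ℕP.<-≤-trans (s≤s z≤n)
              (SubP.x∈p⇒∣p-x∣<∣p∣ (SubP.x∈p∧x≢y⇒x∈p-y (SubP.x∈p∧x≢y⇒x∈p-y z∈p z≢x) z≢y))))
              (SubP.x∈p⇒∣p-x∣<∣p∣ (SubP.x∈p∧x≢y⇒x∈p-y y∈p (λ y≡x → x≢y (sym y≡x))))))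
              (SubP.x∈p⇒∣p-x∣<∣p∣ x∈p)

Extensional : ∀ {n k} → ((Fin k → Fin n) → Set) → Set
Extensional {n} {k} Q = ∀ c c' → (∀ i → c i ≡ c' i) → Q c → Q c'

all-functions? : ∀ {n} k (Q : (Fin k → Fin n) → Set) → Extensional Q → (∀ c → Dec (Q c)) →
                 Dec (∀ c → Q c)
all-functions? zero Q ext Q? with Q? (λ ())
... | yes q = yes λ c → ext (λ ()) c (λ ()) q
... | no ¬q = no λ q → ¬q (q (λ ()))
all-functions? (suc k) Q ext Q?
  with FinP.all? (λ a → all-functions? k (λ c → Q (a ∷ c))
         (λ c c' c≗c' → ext (a ∷ c) (a ∷ c') (λ { Fin.zero → refl ; (Fin.suc i) → c≗c' i }))
         (λ c → Q? (a ∷ c)))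
... | yes q = yes λ c → ext _ c (λ { Fin.zero → refl ; (Fin.suc i) → refl }) (q (head c) (tail c))
... | no ¬q = no λ q → ¬q λ a c → q (a ∷ c)

-- Connectivity

module _ {n m : ℕ} where

  reach-target : ∀ {ρ : QG n m} {X : VSet n} {x y} → Reach ρ X x y → X y
  reach-target (here Xx) = Xx
  reach-target (step a r y∈ z∈ Xz) = Xz

  reach-trans : ∀ {ρ : QG n m} {X : VSet n} {x y z} → Reach ρ X x y → Reach ρ X y z → Reach ρ X x z
  reach-trans r (here _) = r
  reach-trans r (step a r' y∈ z∈ Xz) = step a (reach-trans r r') y∈ z∈ Xz

  reach-sym : ∀ {ρ : QG n m} {X : VSet n} {x y} → Reach ρ X x y → Reach ρ X y x
  reach-sym (here Xx) = here Xx
  reach-sym (step a r y∈ z∈ Xz) = reach-trans (step a (here Xz) z∈ y∈ (reach-target r)) (reach-sym r)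

  reach-map : ∀ {ρ ρ' : QG n m} {X X' : VSet n} {x y} → (∀ z → X z → X' z) →
              (∀ a z → z ∈ ρ a → z ∈ ρ' a) → Reach ρ X x y → Reach ρ' X' x y
  reach-map X⊆X' ρ⊆ρ' (here Xx) = here (X⊆X' _ Xx)
  reach-map X⊆X' ρ⊆ρ' (step a r y∈ z∈ Xz) =
    step a (reach-map X⊆X' ρ⊆ρ' r) (ρ⊆ρ' a _ y∈) (ρ⊆ρ' a _ z∈) (X⊆X' _ Xz)

  reach-widen : ∀ {ρ : QG n m} {X X' : VSet n} {x y} → (∀ z → X z → X' z) → Reach ρ X x y → Reach ρ X' x y
  reach-widen X⊆X' = reach-map X⊆X' (λ a z z∈ → z∈)

  connOn-resp : ∀ {ρ : QG n m} {X X' : VSet n} → (∀ z → X z → X' z) → (∀ z → X' z → X z) →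
                ConnOn ρ X → ConnOn ρ X'
  connOn-resp X⊆X' X'⊆X conn x y Xx Xy = reach-widen X⊆X' (conn x y (X'⊆X x Xx) (X'⊆X y Xy))

  reach-⊖-split : ∀ {ρ : QG n m} {X : VSet n} {x y} a → Reach ρ X x y →
    Reach (ρ ⊖ a) X x y ⊎
    (∃[ p ] ∃[ q ] (p ∈ ρ a × q ∈ ρ a × Reach (ρ ⊖ a) X x p × Reach (ρ ⊖ a) X q y))
  reach-⊖-split a (here Xx) = inj₁ (here Xx)
  reach-⊖-split {ρ} a (step b r y∈ z∈ Xz) with a Fin.≟ b | reach-⊖-split a r
  ... | yes refl | inj₁ r' = inj₂ (_ , _ , y∈ , z∈ , r' , here Xz)
  ... | yes refl | inj₂ (p , q , p∈ , q∈ , r₁ , r₂) = inj₂ (p , _ , p∈ , z∈ , r₁ , here Xz)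
  ... | no a≢b | inj₁ r' = inj₁ (step b r' (∈-⊖⁺ ρ a b a≢b y∈) (∈-⊖⁺ ρ a b a≢b z∈) Xz)
  ... | no a≢b | inj₂ (p , q , p∈ , q∈ , r₁ , r₂) =
    inj₂ (p , q , p∈ , q∈ , r₁ , step b r₂ (∈-⊖⁺ ρ a b a≢b y∈) (∈-⊖⁺ ρ a b a≢b z∈) Xz)

  reach-⊖-bypass : ∀ {ρ : QG n m} {X : VSet n} a →
    (∀ y z → y ∈ ρ a → z ∈ ρ a → X y → X z → Reach (ρ ⊖ a) X y z) →
    ∀ {u v} → Reach ρ X u v → Reach (ρ ⊖ a) X u v
  reach-⊖-bypass a bypass (here Xu) = here Xu
  reach-⊖-bypass {ρ} a bypass (step b r y∈ z∈ Xz) with a Fin.≟ b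
  ... | yes refl = reach-trans (reach-⊖-bypass a bypass r) (bypass _ _ y∈ z∈ (reach-target r) Xz)
  ... | no a≢b = step b (reach-⊖-bypass a bypass r) (∈-⊖⁺ ρ a b a≢b y∈) (∈-⊖⁺ ρ a b a≢b z∈) Xz

  connOn-⊖ : ∀ {ρ : QG n m} {Y : VSet n} {a p q} → ∣ ρ a ∣ ≡ 2 → p ∈ ρ a → q ∈ ρ a → p ≢ q →
             Reach (ρ ⊖ a) Y p q → ConnOn ρ Y → ConnOn (ρ ⊖ a) Y
  connOn-⊖ {ρ} {Y} {a} {p} {q} ∣ρa∣≡2 p∈ q∈ p≢q p~q conn u v Yu Yv =
    reach-⊖-bypass a bypass (conn u v Yu Yv)
    where
      bypass : ∀ y z → y ∈ ρ a → z ∈ ρ a → Y y → Y z → Reach (ρ ⊖ a) Y y z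
      bypass y z y∈ z∈ _ _ with ∣p∣≡2⇒≡⊎≡ ∣ρa∣≡2 p∈ q∈ p≢q y∈ | ∣p∣≡2⇒≡⊎≡ ∣ρa∣≡2 p∈ q∈ p≢q z∈
      ... | inj₁ refl | inj₁ refl = here (reach-target (reach-sym p~q))
      ... | inj₁ refl | inj₂ refl = p~q
      ... | inj₂ refl | inj₁ refl = reach-sym p~q
      ... | inj₂ refl | inj₂ refl = here (reach-target p~q)

module Reachability {n m} (ρ : QG n m) (X : VSet n) (X? : ∀ z → Dec (X z)) (x : Fin n) where

  Extend : Subset n → Fin n → Set
  Extend B z = z ∈ B ⊎ (X z × ∃[ a ] ∃[ y ] (y ∈ B × y ∈ ρ a × z ∈ ρ a))

  extend? : ∀ B z → Dec (Extend B z)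
  extend? B z = (z SubP.∈? B) ⊎-dec (X? z ×-dec FinP.any? (λ a → FinP.any? (λ y →
                  (y SubP.∈? B) ×-dec ((y SubP.∈? ρ a) ×-dec (z SubP.∈? ρ a)))))

  start? : ∀ z → Dec ((z ≡ x) × X z)
  start? z = (z Fin.≟ x) ×-dec X? z

  ball : ℕ → Subset n
  ball zero = fromDec start?
  ball (suc k) = fromDec (extend? (ball k))

  ball-sound : ∀ k z → z ∈ ball k → Reach ρ X x z
  ball-sound zero z z∈ with ∈-fromDec⁻ start? z z∈
  ... | refl , Xz = here Xz
  ball-sound (suc k) z z∈ with ∈-fromDec⁻ (extend? (ball k)) z z∈
  ... | inj₁ z∈' = ball-sound k z z∈'
  ... | inj₂ (Xz , a , y , y∈ , ya , za) = step a (ball-sound k y y∈) ya za Xz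

  ball-complete : ∀ {z} → Reach ρ X x z → ∃[ k ] (z ∈ ball k)
  ball-complete (here Xx) = 0 , ∈-fromDec⁺ start? x (refl , Xx)
  ball-complete (step a r ya za Xz) with ball-complete r
  ... | k , y∈ = suc k , ∈-fromDec⁺ (extend? (ball k)) _ (inj₂ (Xz , a , _ , y∈ , ya , za))

  ball-suc : ∀ k z → z ∈ ball k → z ∈ ball (suc k)
  ball-suc k z z∈ = ∈-fromDec⁺ (extend? (ball k)) z (inj₁ z∈)

  ball-mono : ∀ {j k} → j ℕ.≤ k → ∀ z → z ∈ ball j → z ∈ ball k
  ball-mono j≤k = go (ℕP.≤⇒≤′ j≤k)
    where
      go : ∀ {j k} → j ≤′ k → ∀ z → z ∈ ball j → z ∈ ball k
      go ≤′-refl z z∈ = z∈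
      go (≤′-step {k} j≤′k) z z∈ = ball-suc k z (go j≤′k z z∈)

  Stable : ℕ → Set
  Stable k = ∀ z → z ∈ ball (suc k) → z ∈ ball k

  stable-⊇ : ∀ k → Stable k → ∀ j z → z ∈ ball j → z ∈ ball k
  stable-⊇ k stable zero z z∈ = ball-mono {0} {k} z≤n z z∈
  stable-⊇ k stable (suc j) z z∈ with ∈-fromDec⁻ (extend? (ball j)) z z∈
  ... | inj₁ z∈' = stable-⊇ k stable j z z∈'
  ... | inj₂ (Xz , a , y , y∈ , ya , za) =
    stable z (∈-fromDec⁺ (extend? (ball k)) z (inj₂ (Xz , a , y , stable-⊇ k stable j y y∈ , ya , za)))

  -- Until it stabilises, the ball gains a vertex at every step.
  stable-or-large : ∀ k → (∃[ k' ] Stable k') ⊎ (k ℕ.≤ ∣ ball k ∣)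
  stable-or-large zero = inj₂ z≤n
  stable-or-large (suc k) with stable-or-large k
  ... | inj₁ stable = inj₁ stable
  ... | inj₂ k≤∣ball∣ with FinP.any? (λ z → (z SubP.∈? ball (suc k)) ×-dec ¬? (z SubP.∈? ball k))
  ... | yes (z , z∈ , z∉) =
    inj₂ (ℕP.≤-trans (s≤s k≤∣ball∣) (SubP.p⊂q⇒∣p∣<∣q∣ ((λ {w} → ball-suc k w) , z , z∈ , z∉)))
  ... | no ∄new = inj₁ (k , stable)
    where
      stable : Stable k
      stable z z∈ with z SubP.∈? ball k
      ... | yes z∈' = z∈'
      ... | no z∉ = ⊥-elim (∄new (z , z∈ , z∉))

  stabilises : ∃[ k ] Stable k
  stabilises with stable-or-large (suc n)
  ... | inj₁ stable = stable
  ... | inj₂ large = ⊥-elim (ℕP.<-irrefl refl (ℕP.≤-trans large (SubP.∣p∣≤n (ball (suc n)))))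

  reach? : ∀ z → Dec (Reach ρ X x z)
  reach? z with stabilises
  ... | k , stable with z SubP.∈? ball k
  ... | yes z∈ = yes (ball-sound k z z∈)
  ... | no z∉ = no λ r → z∉ (stable-⊇ k stable (proj₁ (ball-complete r)) z (proj₂ (ball-complete r)))

-- Anticonnectivity and anticomponents

module _ {n m : ℕ} (E : Fin m → Subset n) where

  antiConn-map : ∀ {keep keep' : Fin m → Set} {ρ ρ' : QG n m} {X X' : VSet n} →
    (∀ z → X z → X' z) → (∀ z → X' z → X z) → (∀ f → keep f → keep' f) →
    (∀ f z → z ∈ ρ' f → z ∈ ρ f) → AntiConn E keep ρ X → AntiConn E keep' ρ' X'
  antiConn-map X⊆X' X'⊆X keep⊆ ρ'⊆ρ anti c (x , y , X'x , X'y , cx≢cy)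
    with anti c (x , y , X'⊆X x X'x , X'⊆X y X'y , cx≢cy)
  ... | f , kf , (a , b , aE , bE , Xa , Xb , ca≢cb) , within =
    f , keep⊆ f kf , (a , b , aE , bE , X⊆X' a Xa , X⊆X' b Xb , ca≢cb) ,
    λ u v u∈ v∈ → let (Xu , Xv , cu≡cv) = within u v (ρ'⊆ρ f u u∈) (ρ'⊆ρ f v v∈) in
                  X⊆X' u Xu , X⊆X' v Xv , cu≡cv

  -- a labelling that splits M separates some point of M from y₀
  antiConn-star : ∀ {keep : Fin m → Set} {ρ : QG n m} (M : VSet n) y₀ →
    (∀ z → M z → Σ (VSet n) λ Z → (∀ w → Z w → M w) × Z y₀ × Z z × AntiConn E keep ρ Z) →
    AntiConn E keep ρ M
  antiConn-star {keep} {ρ} M y₀ cover c (x , y , Mx , My , cx≢cy) = split (c x Fin.≟ c y₀)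
    where
      separate : ∀ z → M z → c z ≢ c y₀ → _
      separate z Mz cz≢cy₀ with cover z Mz
      ... | Z , Z⊆M , Zy₀ , Zz , antiZ with antiZ c (z , y₀ , Zz , Zy₀ , cz≢cy₀)
      ... | f , kf , (a , b , aE , bE , Za , Zb , ca≢cb) , within =
        f , kf , (a , b , aE , bE , Z⊆M a Za , Z⊆M b Zb , ca≢cb) ,
        λ u v u∈ v∈ → let (Zu , Zv , cu≡cv) = within u v u∈ v∈ in Z⊆M u Zu , Z⊆M v Zv , cu≡cv
      split : Dec (c x ≡ c y₀) → _
      split (no cx≢cy₀) = separate x Mx cx≢cy₀
      split (yes cx≡cy₀) = separate y My (λ cy≡cy₀ → cx≢cy (trans cx≡cy₀ (sym cy≡cy₀)))

  antiConn-pair : ∀ {keep : Fin m → Set} {ρ : QG n m} {f u v} → keep f → (∀ z → ¬ z ∈ ρ f) →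
                  u ∈ E f → v ∈ E f → AntiConn E keep ρ (_∈ ⁅ u ⁆ ∪ ⁅ v ⁆)
  antiConn-pair {f = f} {u} {v} kf unused u∈ v∈ c (x , y , x∈ , y∈ , cx≢cy) =
    f , kf , (x , y , ∈E x∈ , ∈E y∈ , x∈ , y∈ , cx≢cy) , λ z _ z∈ _ → ⊥-elim (unused z z∈)
    where
      ∈E : ∀ {z} → z ∈ ⁅ u ⁆ ∪ ⁅ v ⁆ → z ∈ E f
      ∈E {z} z∈ with SubP.x∈p∪q⁻ ⁅ u ⁆ ⁅ v ⁆ z∈
      ... | inj₁ z∈⁅u⁆ = subst (_∈ E f) (sym (SubP.x∈⁅y⁆⇒x≡y u z∈⁅u⁆)) u∈
      ... | inj₂ z∈⁅v⁆ = subst (_∈ E f) (sym (SubP.x∈⁅y⁆⇒x≡y v z∈⁅v⁆)) v∈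

  antiConn? : ∀ {keep : Fin m → Set} (keep? : ∀ f → Dec (keep f)) (ρ : QG n m) (X : VSet n) →
              (∀ z → Dec (X z)) → Dec (AntiConn E keep ρ X)
  antiConn? {keep} keep? ρ X X? = all-functions? n Q ext Q?
    where
      Splits : (Fin n → Fin n) → Set
      Splits c = ∃[ x ] ∃[ y ] (X x × X y × c x ≢ c y)
      Witnessed : (Fin n → Fin n) → Set
      Witnessed c = ∃[ f ] (keep f
         × (∃[ x ] ∃[ y ] (x ∈ E f × y ∈ E f × X x × X y × c x ≢ c y))
         × (∀ x y → x ∈ ρ f → y ∈ ρ f → X x × X y × c x ≡ c y))
      Q : (Fin n → Fin n) → Set
      Q c = Splits c → Witnessed c
      ext : Extensional Q
      ext c c' c≗c' q (x , y , Xx , Xy , c'x≢c'y)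
        with q (x , y , Xx , Xy , λ cx≡cy → c'x≢c'y (trans (sym (c≗c' x)) (trans cx≡cy (c≗c' y))))
      ... | f , kf , (a , b , aE , bE , Xa , Xb , ca≢cb) , within =
        f , kf , (a , b , aE , bE , Xa , Xb , λ c'a≡c'b → ca≢cb (trans (c≗c' a) (trans c'a≡c'b (sym (c≗c' b))))) ,
        λ u v u∈ v∈ → let (Xu , Xv , cu≡cv) = within u v u∈ v∈ in
                      Xu , Xv , trans (sym (c≗c' u)) (trans cu≡cv (c≗c' v))
      Q? : ∀ c → Dec (Q c)
      Q? c = splits? →-dec witnessed?
        where
          splits? = FinP.any? λ x → FinP.any? λ y → X? x ×-dec (X? y ×-dec ¬? (c x Fin.≟ c y))
          witnessed? = FinP.any? λ f → keep? f ×-dec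
            ((FinP.any? λ x → FinP.any? λ y → (x SubP.∈? E f) ×-dec ((y SubP.∈? E f) ×-dec
               (X? x ×-dec (X? y ×-dec ¬? (c x Fin.≟ c y))))) ×-dec
             (FinP.all? λ x → FinP.all? λ y → (x SubP.∈? ρ f) →-dec ((y SubP.∈? ρ f) →-dec
               (X? x ×-dec (X? y ×-dec (c x Fin.≟ c y))))))

module _ {n m : ℕ} (E : Fin m → Subset n) {keep : Fin m → Set} where

  sameAnti-resp : ∀ {ρ : QG n m} {X X' : VSet n} {x y} → (∀ z → X z → X' z) → (∀ z → X' z → X z) →
    SameAnti E keep ρ X x y → SameAnti E keep ρ X' x y
  sameAnti-resp X⊆X' X'⊆X (Y , Y⊆X , antiY , x∈ , y∈ , maximal) =
    Y , (λ z z∈ → X⊆X' z (Y⊆X z z∈)) , antiY , x∈ , y∈ ,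
    λ Z Y⊆Z Z⊆X' antiZ → maximal Z Y⊆Z (λ z z∈ → X'⊆X z (Z⊆X' z z∈)) antiZ

  sameAnti-sym : ∀ {ρ : QG n m} {X : VSet n} {x y} → SameAnti E keep ρ X x y → SameAnti E keep ρ X y x
  sameAnti-sym (Y , Y⊆X , antiY , x∈ , y∈ , maximal) = Y , Y⊆X , antiY , y∈ , x∈ , maximal

  sameAnti-trans : ∀ {ρ : QG n m} {X : VSet n} {x y z} → SameAnti E keep ρ X x y → SameAnti E keep ρ X y z →
    SameAnti E keep ρ X x z
  sameAnti-trans {ρ} {X} {x} {y} {z} (Y , Y⊆X , antiY , x∈ , y∈ , maximal) (Y' , Y'⊆X , antiY' , y∈' , z∈' , _) =
    Y , Y⊆X , antiY , x∈ , maximal (Y ∪ Y') (SubP.p⊆p∪q Y') ∪⊆X anti∪ (SubP.q⊆p∪q Y Y' z∈') , maximal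
    where
      ∪⊆X : ∀ w → w ∈ Y ∪ Y' → X w
      ∪⊆X w w∈ with SubP.x∈p∪q⁻ Y Y' w∈
      ... | inj₁ w∈Y = Y⊆X w w∈Y
      ... | inj₂ w∈Y' = Y'⊆X w w∈Y'
      anti∪ : AntiConn E keep ρ (_∈ Y ∪ Y')
      anti∪ = antiConn-star E (_∈ Y ∪ Y') y cover
        where
          cover : ∀ w → w ∈ Y ∪ Y' → _
          cover w w∈ with SubP.x∈p∪q⁻ Y Y' w∈
          ... | inj₁ w∈Y = (_∈ Y) , (λ v → SubP.p⊆p∪q Y') , y∈ , w∈Y , antiY
          ... | inj₂ w∈Y' = (_∈ Y') , (λ v → SubP.q⊆p∪q Y Y') , y∈' , w∈Y' , antiY'

module _ {n m : ℕ} (E : Fin m → Subset n) {keep : Fin m → Set} (keep? : ∀ f → Dec (keep f)) where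

  -- the anticomponent containing Y₀ is the union of all anticonnected Z ⊇ Y₀ inside X
  antiConn⇒sameAnti : ∀ (ρ : QG n m) (X : VSet n) (X? : ∀ z → Dec (X z)) (Y₀ : Subset n) →
    (∀ z → z ∈ Y₀ → X z) → AntiConn E keep ρ (_∈ Y₀) → ∀ {x y} → x ∈ Y₀ → y ∈ Y₀ →
    SameAnti E keep ρ X x y
  antiConn⇒sameAnti ρ X X? Y₀ Y₀⊆X antiY₀ {x} {y} x∈ y∈ =
    M , M⊆X , antiM , Y₀⊆M x∈ , Y₀⊆M y∈ , maximal
    where
      InAnti⊇Y₀ : Fin n → Set
      InAnti⊇Y₀ z = ∃[ Z ] (Y₀ ⊆ Z × (∀ w → w ∈ Z → X w) × AntiConn E keep ρ (_∈ Z) × z ∈ Z)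
      inAnti⊇Y₀? : ∀ z → Dec (InAnti⊇Y₀ z)
      inAnti⊇Y₀? z = SubP.anySubset? λ Z → (Y₀ SubP.⊆? Z) ×-dec ((FinP.all? λ w → (w SubP.∈? Z) →-dec X? w) ×-dec
                      (antiConn? E keep? ρ (_∈ Z) (λ w → w SubP.∈? Z) ×-dec (z SubP.∈? Z)))
      M : Subset n
      M = fromDec inAnti⊇Y₀?
      ∈M : ∀ {z} → InAnti⊇Y₀ z → z ∈ M
      ∈M = ∈-fromDec⁺ inAnti⊇Y₀? _
      Y₀⊆M : Y₀ ⊆ M
      Y₀⊆M w∈ = ∈M (Y₀ , (λ w → w) , Y₀⊆X , antiY₀ , w∈)
      M⊆X : ∀ z → z ∈ M → X z
      M⊆X z z∈ with ∈-fromDec⁻ inAnti⊇Y₀? z z∈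
      ... | Z , _ , Z⊆X , _ , z∈Z = Z⊆X z z∈Z
      antiM : AntiConn E keep ρ (_∈ M)
      antiM = antiConn-star E (_∈ M) x cover
        where
          cover : ∀ z → z ∈ M → _
          cover z z∈ with ∈-fromDec⁻ inAnti⊇Y₀? z z∈
          ... | Z , Y₀⊆Z , Z⊆X , antiZ , z∈Z =
            (_∈ Z) , (λ w w∈Z → ∈M (Z , Y₀⊆Z , Z⊆X , antiZ , w∈Z)) , Y₀⊆Z x∈ , z∈Z , antiZ
      maximal : ∀ Z → M ⊆ Z → (∀ z → z ∈ Z → X z) → AntiConn E keep ρ (_∈ Z) → Z ⊆ M
      maximal Z M⊆Z Z⊆X antiZ z∈ = ∈M (Z , (λ w∈ → M⊆Z (Y₀⊆M w∈)) , Z⊆X , antiZ , z∈)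

  sameAnti-refl : ∀ (ρ : QG n m) (X : VSet n) (X? : ∀ z → Dec (X z)) {x} → X x → SameAnti E keep ρ X x x
  sameAnti-refl ρ X X? {x} Xx =
    antiConn⇒sameAnti ρ X X? ⁅ x ⁆ (λ z z∈ → subst X (sym (SubP.x∈⁅y⁆⇒x≡y x z∈)) Xx) anti⁅x⁆
      (SubP.x∈⁅x⁆ x) (SubP.x∈⁅x⁆ x)
    where
      anti⁅x⁆ : AntiConn E keep ρ (_∈ ⁅ x ⁆)
      anti⁅x⁆ c (a , b , a∈ , b∈ , ca≢cb) with SubP.x∈⁅y⁆⇒x≡y x a∈ | SubP.x∈⁅y⁆⇒x≡y x b∈
      ... | refl | refl = ⊥-elim (ca≢cb refl)

  sameAnti? : ∀ (ρ : QG n m) (X : VSet n) (X? : ∀ z → Dec (X z)) x y → Dec (SameAnti E keep ρ X x y)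
  sameAnti? ρ X X? x y = SubP.anySubset? λ Y →
    (FinP.all? λ z → (z SubP.∈? Y) →-dec X? z) ×-dec (antiConn? E keep? ρ (_∈ Y) (λ w → w SubP.∈? Y) ×-dec
    ((x SubP.∈? Y) ×-dec ((y SubP.∈? Y) ×-dec (all-subsets? λ Z → (Y SubP.⊆? Z) →-dec
      ((FinP.all? λ z → (z SubP.∈? Z) →-dec X? z) →-dec
      (antiConn? E keep? ρ (_∈ Z) (λ w → w SubP.∈? Z) →-dec (Z SubP.⊆? Y)))))))

  sameAnti-mono : ∀ {ρ ρ' : QG n m} (X : VSet n) (X? : ∀ z → Dec (X z)) → (∀ f z → z ∈ ρ' f → z ∈ ρ f) →
    ∀ {x y} → SameAnti E keep ρ X x y → SameAnti E keep ρ' X x y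
  sameAnti-mono {ρ} {ρ'} X X? ρ'⊆ρ (Y , Y⊆X , antiY , x∈ , y∈ , _) =
    antiConn⇒sameAnti ρ' X X? Y Y⊆X (antiConn-map E (λ z p → p) (λ z p → p) (λ f k → k) ρ'⊆ρ antiY) x∈ y∈

-- Partitions and their refinements

module _ {n : ℕ} where

  ≤P-refl : {P : Part n} → P ≤P P
  ≤P-refl x y p = p

  ≤P-trans : {P Q R : Part n} → P ≤P Q → Q ≤P R → P ≤P R
  ≤P-trans P≤Q Q≤R x y p = Q≤R x y (P≤Q x y p)

  ≈P-refl : {P : Part n} → P ≈P P
  ≈P-refl = ≤P-refl , ≤P-refl

  ≈P-sym : {P Q : Part n} → P ≈P Q → Q ≈P P
  ≈P-sym (P≤Q , Q≤P) = Q≤P , P≤Q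

  ≈P-trans : {P Q R : Part n} → P ≈P Q → Q ≈P R → P ≈P R
  ≈P-trans (P≤Q , Q≤P) (Q≤R , R≤Q) = ≤P-trans P≤Q Q≤R , ≤P-trans R≤Q Q≤P

  ≤P-isPreorder : IsPreorder (_≈P_ {n}) _≤P_
  ≤P-isPreorder = record
    { isEquivalence = record { refl = ≈P-refl ; sym = ≈P-sym ; trans = ≈P-trans }
    ; reflexive = proj₁
    ; trans = ≤P-trans }

  ≤P-preorder : Preorder _ _ _
  ≤P-preorder = record { isPreorder = ≤P-isPreorder }

  module ≤P-Reasoning = Relation.Binary.Reasoning.Preorder ≤P-preorder

  ≤P? : {P Q : Part n} → (∀ x y → Dec (P x y)) → (∀ x y → Dec (Q x y)) → Dec (P ≤P Q)
  ≤P? P? Q? = FinP.all? λ x → FinP.all? λ y → P? x y →-dec Q? x y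

  isDecEquivalence-resp : {P Q : Part n} → P ≈P Q → IsDecEquivalence P → IsDecEquivalence Q
  isDecEquivalence-resp (P≤Q , Q≤P) isDecEq = record
    { isEquivalence = record
      { refl = P≤Q _ _ P.refl
      ; sym = λ q → P≤Q _ _ (P.sym (Q≤P _ _ q))
      ; trans = λ q q' → P≤Q _ _ (P.trans (Q≤P _ _ q) (Q≤P _ _ q')) }
    ; _≟_ = λ x y → map′ (P≤Q x y) (Q≤P x y) (x P.≟ y) }
    where module P = IsDecEquivalence isDecEq

  full-isDecEquivalence : IsDecEquivalence (Full {n})
  full-isDecEquivalence = record
    { isEquivalence = record { refl = tt ; sym = λ _ → tt ; trans = λ _ _ → tt }
    ; _≟_ = λ _ _ → yes tt }

  module _ {P : Part n} (isEq : IsEquivalence P) where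
    private module P = IsEquivalence isEq

    class⊆ : ∀ {x y} → P x y → ∀ z → P y z → P x z
    class⊆ x~y z = P.trans x~y

    class⊇ : ∀ {x y} → P x y → ∀ z → P x z → P y z
    class⊇ x~y z = P.trans (P.sym x~y)

    class-related : ∀ {X u v} → IsClass P X → u ∈ X → v ∈ X → P u v
    class-related (r , _ , cls) u∈ v∈ = P.trans (P.sym (proj₁ (cls _) u∈)) (proj₁ (cls _) v∈)

-- for an equivalence Q and nonempty X: X lies inside one class of Q
WithinClass : ∀ {n} → Part n → Subset n → Set
WithinClass Q X = ∀ x z z' → z ∈ X → z' ∈ X → Q x z → Q x z'

withinClass-resp : ∀ {n} {Q Q' : Part n} {X} → Q ≈P Q' → WithinClass Q X → WithinClass Q' X
withinClass-resp (Q≤Q' , Q'≤Q) within x z z' z∈ z'∈ x~z = Q≤Q' x z' (within x z z' z∈ z'∈ (Q'≤Q x z x~z))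

class⇒withinClass : ∀ {n} {R Q : Part n} {X} → IsEquivalence R → IsEquivalence Q →
                    IsClass R X → R ≤P Q → WithinClass Q X
class⇒withinClass isEqR isEqQ cls R≤Q x z z' z∈ z'∈ x~z =
  IsEquivalence.trans isEqQ x~z (R≤Q z z' (class-related isEqR cls z∈ z'∈))

keepAll? : ∀ {m} (f : Fin m) → Dec (AllE f)
keepAll? f = yes tt

keepOthers? : ∀ {m} (a : Fin m) (f : Fin m) → Dec (f ≢ a)
keepOthers? a f = ¬? (f Fin.≟ a)

module _ {n m : ℕ} where

  compRef-≤ : ∀ (ρ : QG n m) (Q : Part n) → CompRef ρ Q ≤P Q
  compRef-≤ ρ Q x y = proj₁

  antiRef-≤ : ∀ E keep (ρ : QG n m) (Q : Part n) → AntiRef E keep ρ Q ≤P Q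
  antiRef-≤ E keep ρ Q x y = proj₁

  compRef-cong : ∀ (ρ : QG n m) {Q Q' : Part n} → Q ≈P Q' → CompRef ρ Q ≈P CompRef ρ Q'
  compRef-cong ρ (Q≤Q' , Q'≤Q) = (λ x y (q , r) → Q≤Q' x y q , reach-widen (Q≤Q' x) r) ,
                                 (λ x y (q , r) → Q'≤Q x y q , reach-widen (Q'≤Q x) r)

  antiRef-cong : ∀ E {keep} (ρ : QG n m) {Q Q' : Part n} → Q ≈P Q' →
    AntiRef E keep ρ Q ≈P AntiRef E keep ρ Q'
  antiRef-cong E ρ (Q≤Q' , Q'≤Q) =
    (λ x y (q , s) → Q≤Q' x y q , sameAnti-resp E (Q≤Q' x) (Q'≤Q x) s) ,
    (λ x y (q , s) → Q'≤Q x y q , sameAnti-resp E (Q'≤Q x) (Q≤Q' x) s)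

  compRef-isDecEquivalence : ∀ (ρ : QG n m) {Q : Part n} → IsDecEquivalence Q →
                             IsDecEquivalence (CompRef ρ Q)
  compRef-isDecEquivalence ρ {Q} isDecEq = record
    { isEquivalence = record
      { refl = Q.refl , here Q.refl
      ; sym = λ (q , r) → Q.sym q , reach-widen (class⊇ Q.isEquivalence q) (reach-sym r)
      ; trans = λ (q , r) (q' , r') → Q.trans q q' , reach-trans r (reach-widen (class⊆ Q.isEquivalence q) r') }
    ; _≟_ = λ x y → (x Q.≟ y) ×-dec Reachability.reach? ρ (Q x) (x Q.≟_) x y }
    where module Q = IsDecEquivalence isDecEq

  antiRef-isDecEquivalence : ∀ E {keep} (keep? : ∀ f → Dec (keep f)) (ρ : QG n m) {Q : Part n} →
                             IsDecEquivalence Q → IsDecEquivalence (AntiRef E keep ρ Q)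
  antiRef-isDecEquivalence E keep? ρ {Q} isDecEq = record
    { isEquivalence = record
      { refl = Q.refl , sameAnti-refl E keep? ρ (Q _) (_ Q.≟_) Q.refl
      ; sym = λ (q , s) → Q.sym q ,
          sameAnti-resp E (class⊇ Q.isEquivalence q) (class⊆ Q.isEquivalence q) (sameAnti-sym E s)
      ; trans = λ (q , s) (q' , s') → Q.trans q q' ,
          sameAnti-trans E s (sameAnti-resp E (class⊆ Q.isEquivalence q) (class⊇ Q.isEquivalence q) s') }
    ; _≟_ = λ x y → (x Q.≟ y) ×-dec sameAnti? E keep? ρ (Q x) (x Q.≟_) x y }
    where module Q = IsDecEquivalence isDecEq

module _ {n m : ℕ} (E : Fin m → Subset n) where

  refine-view : ∀ j → (∀ ρ Q → Refine E ρ j Q ≡ CompRef ρ Q) ⊎ (∀ ρ Q → Refine E ρ j Q ≡ AntiRef E AllE ρ Q)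
  refine-view zero = inj₁ λ ρ Q → refl
  refine-view (suc zero) = inj₂ λ ρ Q → refl
  refine-view (suc (suc j)) = refine-view j

  refine-recurs : ∀ N j → ∃[ J ] (N ℕ.≤ J × (∀ ρ Q → Refine E ρ J Q ≡ Refine E ρ j Q))
  refine-recurs zero j = j , z≤n , λ ρ Q → refl
  refine-recurs (suc N) j with refine-recurs N j
  ... | J , N≤J , same = suc (suc J) , ℕP.m≤n⇒m≤1+n (s≤s N≤J) , same

  refine-isDecEquivalence : ∀ (ρ : QG n m) j {Q : Part n} → IsDecEquivalence Q →
                            IsDecEquivalence (Refine E ρ j Q)
  refine-isDecEquivalence ρ zero = compRef-isDecEquivalence ρ
  refine-isDecEquivalence ρ (suc zero) = antiRef-isDecEquivalence E keepAll? ρ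
  refine-isDecEquivalence ρ (suc (suc j)) = refine-isDecEquivalence ρ j

  refine-≤ : ∀ (ρ : QG n m) j (Q : Part n) → Refine E ρ j Q ≤P Q
  refine-≤ ρ zero Q = compRef-≤ ρ Q
  refine-≤ ρ (suc zero) Q = antiRef-≤ E AllE ρ Q
  refine-≤ ρ (suc (suc j)) Q = refine-≤ ρ j Q

  refine-cong : ∀ (ρ : QG n m) j {Q Q' : Part n} → Q ≈P Q' → Refine E ρ j Q ≈P Refine E ρ j Q'
  refine-cong ρ zero = compRef-cong ρ
  refine-cong ρ (suc zero) = antiRef-cong E ρ
  refine-cong ρ (suc (suc j)) = refine-cong ρ j

-- Plane sequences

next≢ : ∀ {k} (t : Fin (suc (suc k))) → next t ≢ t
next≢ {k} t next≡t with suc (toℕ t) ℕ.≤? suc k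
... | yes p = ℕP.1+n≢n (trans (sym (FinP.toℕ-fromℕ< (s≤s p))) (cong toℕ next≡t))
next≢ {k} Fin.zero next≡t | no ¬p = ¬p (s≤s z≤n)
next≢ {k} (Fin.suc t) () | no ¬p

terminal? : ∀ {m} (d : D m) → Dec (Terminal d)
terminal? (edge a) = no λ { (inj₁ ()) ; (inj₂ ()) }
terminal? STOP = yes (inj₁ refl)
terminal? TERMINATE = yes (inj₂ refl)

edge-¬terminal : ∀ {m} {d : D m} {a} → d ≡ edge a → ¬ Terminal d
edge-¬terminal refl (inj₁ ())
edge-¬terminal refl (inj₂ ())

crossing-anti : ∀ {n} {P P' : Part n} {s : Subset n} → P ≤P P' → Crossing P' s → Crossing P s
crossing-anti P≤P' (x , y , x∈ , y∈ , ¬P'xy) = x , y , x∈ , y∈ , λ Pxy → ¬P'xy (P≤P' x y Pxy)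

module _ {n m : ℕ} (E : Fin m → Subset n) where

  qCyc-map : ∀ {π π' : QG n m} {P P' : Part n} → P ≈P P' →
    (∀ a → ¬ Crossing P (π a) → ¬ Crossing P' (π' a)) → QCyc E π P → QCyc E π' P'
  qCyc-map {P = P} {P'} (P≤P' , P'≤P) unused⇒unused γ = record
    { k = k ; edg = edg ; edg-inj = edg-inj ; rep = rep
    ; rep-distinct = λ s t p → rep-distinct s t (P'≤P _ _ p)
    ; meets = λ t → let ((u , u∈ , pu) , (v , v∈ , pv)) = meets t in
                    (u , u∈ , P≤P' _ _ pu) , (v , v∈ , P≤P' _ _ pv)
    ; unused = λ t → unused⇒unused (edg t) (unused t) }
    where open QCyc γ

  qCyc-resp : ∀ {π : QG n m} {P P' : Part n} → P ≈P P' → QCyc E π P → QCyc E π P'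
  qCyc-resp P≈P' = qCyc-map P≈P' (λ a ¬crossing crossing → ¬crossing (crossing-anti (proj₁ P≈P') crossing))

  rep-next-apart : ∀ {π : QG n m} {P : Part n} (γ : QCyc E π P) t →
                   ¬ P (QCyc.rep γ t) (QCyc.rep γ (next t))
  rep-next-apart γ t p = next≢ t (sym (QCyc.rep-distinct γ t (next t) p))

  inL-map : ∀ {π π' : QG n m} {S S' : Seq n m} {P P' : Part n} {a} → P ≈P P' →
    (∀ a → ¬ Crossing P (π a) → ¬ Crossing P' (π' a)) →
    (∀ x y p → ¬ P x y → ExpStep S x y p → ExpStep S' x y p) →
    (∀ x y p → ¬ P x y → ExpStep S' x y p → ExpStep S x y p) →
    InL E π S P a → InL E π' S' P' a
  inL-map P≈P' unused⇒unused exp⇒exp' exp'⇒exp (γ , t , edg≡a , (p , expt , least)) =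
    qCyc-map P≈P' unused⇒unused γ , t , edg≡a ,
    (p , exp⇒exp' _ _ p (rep-next-apart γ t) expt ,
     λ r q exp'r → least r q (exp'⇒exp _ _ q (rep-next-apart γ r) exp'r))

  module _ {π : QG n m} where

    xBridge-used : ∀ {a X} → XBridge E π a X → Used π a
    xBridge-used (_ , _ , _ , used , _) = used

    xAntibridge-unused : ∀ {a X} → XAntibridge E π a X → ¬ Used π a
    xAntibridge-unused (_ , _ , _ , unused , _) = unused

    xBridge-resp : ∀ {a} {X X' : VSet n} → (∀ z → X z → X' z) → (∀ z → X' z → X z) →
      XBridge E π a X → XBridge E π a X'
    xBridge-resp X⊆X' X'⊆X (conn , anti , (u , v , u≢v , ue , ve , Xu , Xv , only) , used , sub , ¬conn) =
      connOn-resp X⊆X' X'⊆X conn , antiConn-map E X⊆X' X'⊆X (λ _ k → k) (λ _ _ z → z) anti ,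
      (u , v , u≢v , ue , ve , X⊆X' u Xu , X⊆X' v Xv , λ w we X'w → only w we (X'⊆X w X'w)) ,
      used , (λ x x∈ → X⊆X' x (sub x x∈)) , λ conn' → ¬conn (connOn-resp X'⊆X X⊆X' conn')

    xAntibridge-resp : ∀ {a} {X X' : VSet n} → (∀ z → X z → X' z) → (∀ z → X' z → X z) →
      XAntibridge E π a X → XAntibridge E π a X'
    xAntibridge-resp X⊆X' X'⊆X (conn , anti , (u , v , u≢v , ue , ve , Xu , Xv , only) , unused , ¬anti) =
      connOn-resp X⊆X' X'⊆X conn , antiConn-map E X⊆X' X'⊆X (λ _ k → k) (λ _ _ z → z) anti ,
      (u , v , u≢v , ue , ve , X⊆X' u Xu , X⊆X' v Xv , λ w we X'w → only w we (X'⊆X w X'w)) ,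
      unused , λ anti' → ¬anti (antiConn-map E X'⊆X X⊆X' (λ _ k → k) (λ _ _ z → z) anti')

    weaklyRedundant-resp : ∀ {P P' : Part n} {a} → P ≈P P' → WeaklyRedundant E π P a → WeaklyRedundant E π P' a
    weaklyRedundant-resp (P≤P' , P'≤P) (inj₁ (crossing , unused , ¬antibridge)) =
      inj₁ (crossing-anti P'≤P crossing , unused ,
            λ (w , xa) → ¬antibridge (w , xAntibridge-resp (P'≤P w) (P≤P' w) xa))
    weaklyRedundant-resp (P≤P' , P'≤P) (inj₂ (crossing , used , ¬bridge)) =
      inj₂ (crossing-anti P'≤P crossing , used , λ (w , xb) → ¬bridge (w , xBridge-resp (P'≤P w) (P≤P' w) xb))

antitone : ∀ {n} (F : ℕ → Part n) → (∀ k → F (suc k) ≤P F k) → ∀ {j k} → j ℕ.≤ k → F k ≤P F j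
antitone F F-suc j≤k = go (ℕP.≤⇒≤′ j≤k)
  where
    go : ∀ {j k} → j ≤′ k → F k ≤P F j
    go ≤′-refl = ≤P-refl
    go (≤′-step {k} j≤′k) = ≤P-trans (F-suc k) (go j≤′k)

InSig-pred : ∀ {n m} {S : Seq n m} {i} → InSig S (suc i) → InSig S i
InSig-pred inSig k k<i = inSig k (ℕP.m≤n⇒m≤1+n k<i)

InSig⇒≤terminal : ∀ {n m} {S : Seq n m} {i ℓ} → InSig S i → Terminal (d S ℓ) → i ℕ.≤ ℓ
InSig⇒≤terminal {i = i} {ℓ} inSig term with ℕP.≤-<-connex i ℓ
... | inj₁ i≤ℓ = i≤ℓ
... | inj₂ ℓ<i = ⊥-elim (inSig ℓ ℓ<i term)

RoundCut : ∀ {n m} → (Fin m → Subset n) → QG n m → Seq n m → ℕ → Fin m → Set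
RoundCut E ρ S i a =
    (PAntibridge E ρ (Pinf S i) a × (P S (suc i) 0 ≈P AntiRef E (λ f → f ≢ a) ρ (Pinf S i)))
  ⊎ (PBridge E ρ (Pinf S i) a × (P S (suc i) 0 ≈P CompRef (ρ ⊖ a) (Pinf S i)))

module PlaneSeqProperties {n m} (E : Fin m → Subset n) (ρ : QG n m) (S : Seq n m) (ps : PlaneSeq E ρ S) where

  P₀₀≈Full : P S 0 0 ≈P Full
  P₀₀≈Full = proj₁ ps

  P-step : ∀ i j → P S i (suc j) ≈P Refine E ρ j (P S i j)
  P-step = proj₁ (proj₂ ps)

  row-limit : ∀ i → ∃[ N ] (∀ j → N ℕ.≤ j → P S i j ≈P Pinf S i)
  row-limit = proj₁ (proj₂ (proj₂ ps))

  Pinf-limit : ∃[ N ] (∀ i → N ℕ.≤ i → Pinf S i ≈P Pii S)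
  Pinf-limit = proj₁ (proj₂ (proj₂ (proj₂ ps)))

  round : ∀ i → Round E ρ S i
  round = proj₂ (proj₂ (proj₂ (proj₂ ps)))

  row-start : ∀ i → (P S (suc i) 0 ≈P Pinf S i) ⊎ (∃[ a ] ((d S i ≡ edge a) × RoundCut E ρ S i a))
  row-start i with round i
  ... | inj₁ (_ , P'≈P , _) = inj₁ P'≈P
  ... | inj₂ (inj₁ (_ , _ , P'≈P , _)) = inj₁ P'≈P
  ... | inj₂ (inj₂ (_ , _ , a , _ , d≡a , next)) = inj₂ (a , d≡a , next)

  row-isDecEquivalence : ∀ i → IsDecEquivalence (P S i 0) → ∀ j → IsDecEquivalence (P S i j)
  row-isDecEquivalence i isDecEq zero = isDecEq
  row-isDecEquivalence i isDecEq (suc j) =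
    isDecEquivalence-resp (≈P-sym (P-step i j)) (refine-isDecEquivalence E ρ j (row-isDecEquivalence i isDecEq j))

  limit-isDecEquivalence : ∀ i → IsDecEquivalence (P S i 0) → IsDecEquivalence (Pinf S i)
  limit-isDecEquivalence i isDecEq =
    isDecEquivalence-resp (proj₂ (row-limit i) _ ℕP.≤-refl) (row-isDecEquivalence i isDecEq (proj₁ (row-limit i)))

  start-isDecEquivalence : ∀ i → IsDecEquivalence (P S i 0)
  start-isDecEquivalence zero = isDecEquivalence-resp (≈P-sym P₀₀≈Full) full-isDecEquivalence
  start-isDecEquivalence (suc i) with row-start i
  ... | inj₁ P'≈P = isDecEquivalence-resp (≈P-sym P'≈P) Pinf-isDecEq
    where Pinf-isDecEq = limit-isDecEquivalence i (start-isDecEquivalence i)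
  ... | inj₂ (a , _ , inj₁ (_ , P'≈P)) = isDecEquivalence-resp (≈P-sym P'≈P)
    (antiRef-isDecEquivalence E (keepOthers? a) ρ (limit-isDecEquivalence i (start-isDecEquivalence i)))
  ... | inj₂ (a , _ , inj₂ (_ , P'≈P)) = isDecEquivalence-resp (≈P-sym P'≈P)
    (compRef-isDecEquivalence (ρ ⊖ a) (limit-isDecEquivalence i (start-isDecEquivalence i)))

  P-isDecEquivalence : ∀ i j → IsDecEquivalence (P S i j)
  P-isDecEquivalence i = row-isDecEquivalence i (start-isDecEquivalence i)

  Pinf-isDecEquivalence : ∀ i → IsDecEquivalence (Pinf S i)
  Pinf-isDecEquivalence i = limit-isDecEquivalence i (start-isDecEquivalence i)

  Pii-isDecEquivalence : IsDecEquivalence (Pii S)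
  Pii-isDecEquivalence =
    isDecEquivalence-resp (proj₂ Pinf-limit _ ℕP.≤-refl) (Pinf-isDecEquivalence (proj₁ Pinf-limit))

  P-suc-≤ : ∀ i j → P S i (suc j) ≤P P S i j
  P-suc-≤ i j = ≤P-trans (proj₁ (P-step i j)) (refine-≤ E ρ j (P S i j))

  P-antitone : ∀ i {j j'} → j ℕ.≤ j' → P S i j' ≤P P S i j
  P-antitone i = antitone (P S i) (P-suc-≤ i)

  Pinf-≤-P : ∀ i j → Pinf S i ≤P P S i j
  Pinf-≤-P i j = ≤P-trans (proj₂ (proj₂ (row-limit i) (j + N) (ℕP.m≤n+m N j))) (P-antitone i (ℕP.m≤m+n j N))
    where N = proj₁ (row-limit i)

  P-next-≤-Pinf : ∀ i → P S (suc i) 0 ≤P Pinf S i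
  P-next-≤-Pinf i with row-start i
  ... | inj₁ P'≈P = proj₁ P'≈P
  ... | inj₂ (a , _ , inj₁ (_ , P'≈P)) = ≤P-trans (proj₁ P'≈P) (antiRef-≤ E _ ρ (Pinf S i))
  ... | inj₂ (a , _ , inj₂ (_ , P'≈P)) = ≤P-trans (proj₁ P'≈P) (compRef-≤ (ρ ⊖ a) (Pinf S i))

  Pinf-antitone : ∀ {i i'} → i ℕ.≤ i' → Pinf S i' ≤P Pinf S i
  Pinf-antitone = antitone (Pinf S) (λ i → ≤P-trans (Pinf-≤-P (suc i) 0) (P-next-≤-Pinf i))

  P-later-≤-Pinf : ∀ {i i'} → i ℕ.< i' → ∀ j → P S i' j ≤P Pinf S i
  P-later-≤-Pinf {i} {suc i'} (s≤s i≤i') j =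
    ≤P-trans (P-antitone (suc i') z≤n) (≤P-trans (P-next-≤-Pinf i') (Pinf-antitone i≤i'))

  Pii-≤-Pinf : ∀ i → Pii S ≤P Pinf S i
  Pii-≤-Pinf i = ≤P-trans (proj₂ (proj₂ Pinf-limit (i + N) (ℕP.m≤n+m N i))) (Pinf-antitone (ℕP.m≤m+n i N))
    where N = proj₁ Pinf-limit

  Pinf-refine-stable : ∀ i j {Q : Part n} → Q ≈P Pinf S i → Refine E ρ j Q ≈P Pinf S i
  Pinf-refine-stable i j {Q} Q≈Pinf with refine-recurs E (proj₁ (row-limit i)) j
  ... | J , N≤J , same = begin-equality
    Refine E ρ j Q            ≈⟨ refine-cong E ρ j (≈P-trans Q≈Pinf (≈P-sym (limit J N≤J))) ⟩
    Refine E ρ j (P S i J)    ≡⟨ same ρ (P S i J) ⟨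
    Refine E ρ J (P S i J)    ≈⟨ P-step i J ⟨
    P S i (suc J)             ≈⟨ limit (suc J) (ℕP.m≤n⇒m≤1+n N≤J) ⟩
    Pinf S i                  ∎
    where
      open ≤P-Reasoning
      limit = proj₂ (row-limit i)

  row-const : ∀ i k → P S i 0 ≈P Pinf S k → ∀ j → P S i j ≈P Pinf S k
  row-const i k P₀≈ zero = P₀≈
  row-const i k P₀≈ (suc j) = ≈P-trans (P-step i j) (Pinf-refine-stable k j (row-const i k P₀≈ j))

  Pinf-const : ∀ i k → P S i 0 ≈P Pinf S k → Pinf S i ≈P Pinf S k
  Pinf-const i k P₀≈ = ≈P-trans (≈P-sym (proj₂ (row-limit i) _ ℕP.≤-refl)) (row-const i k P₀≈ _)

  terminal⇒next≈Pinf : ∀ k → Terminal (d S k) → P S (suc k) 0 ≈P Pinf S k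
  terminal⇒next≈Pinf k term with row-start k
  ... | inj₁ P'≈P = P'≈P
  ... | inj₂ (a , d≡a , _) = ⊥-elim (edge-¬terminal d≡a term)

  -- the round data is read off 𝒫_{k,∞} alone, so an unchanged partition repeats the verdict
  terminal-persists : ∀ k → Terminal (d S k) → Pinf S (suc k) ≈P Pinf S k → Terminal (d S (suc k))
  terminal-persists k term Pinf≈ with round (suc k)
  ... | inj₁ (_ , _ , d≡T) = inj₂ d≡T
  ... | inj₂ (inj₁ (_ , _ , _ , d≡S)) = inj₁ d≡S
  ... | inj₂ (inj₂ (γ , ∄wr , a , _ , d≡a , _)) with round k
  ...   | inj₁ (∄γ , _) = ⊥-elim (∄γ (qCyc-resp E Pinf≈ γ))
  ...   | inj₂ (inj₁ (_ , (b , b∈L , wr) , _)) =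
          ⊥-elim (∄wr (b , inL-map E (≈P-sym Pinf≈) (λ a ¬c c → ¬c (crossing-anti (proj₂ Pinf≈) c))
                    (λ x y p _ exp → exp) (λ x y p _ exp → exp) b∈L , weaklyRedundant-resp E (≈P-sym Pinf≈) wr))
  ...   | inj₂ (inj₂ (_ , _ , _ , _ , d≡a' , _)) = ⊥-elim (edge-¬terminal d≡a' term)

  AfterTerminal : ℕ → ℕ → Set
  AfterTerminal k i = Terminal (d S i) × (Pinf S i ≈P Pinf S k) × (∀ j → P S (suc i) j ≈P Pinf S k)

  after-terminal : ∀ {k} → Terminal (d S k) → ∀ {i} → k ℕ.≤ i → AfterTerminal k i
  after-terminal {k} term k≤i = go (ℕP.≤⇒≤′ k≤i)
    where
      go : ∀ {i} → k ≤′ i → AfterTerminal k i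
      go ≤′-refl = term , ≈P-refl , row-const (suc k) k (terminal⇒next≈Pinf k term)
      go (≤′-step {i} k≤′i) with go k≤′i
      ... | term-i , Pinf-i≈ , row-i≈ =
        term' , Pinf≈ , row-const (suc (suc i)) k (≈P-trans (terminal⇒next≈Pinf (suc i) term') Pinf≈)
        where
          Pinf≈ : Pinf S (suc i) ≈P Pinf S k
          Pinf≈ = Pinf-const (suc i) k (row-i≈ 0)
          term' : Terminal (d S (suc i))
          term' = terminal-persists i term-i (≈P-trans Pinf≈ (≈P-sym Pinf-i≈))

  Pii≈terminal : ∀ k → Terminal (d S k) → Pii S ≈P Pinf S k
  Pii≈terminal k term = ≈P-trans (≈P-sym (proj₂ Pinf-limit (k + N) (ℕP.m≤n+m N k)))
                                 (proj₁ (proj₂ (after-terminal term (ℕP.m≤m+n k N))))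
    where N = proj₁ Pinf-limit

  stop⇒cycle : ∀ i → d S i ≡ STOP → QCyc E ρ (Pinf S i)
  stop⇒cycle i d≡S with round i
  ... | inj₁ (_ , _ , d≡T) with trans (sym d≡S) d≡T
  ...   | ()
  stop⇒cycle i d≡S | inj₂ (inj₁ (γ , _)) = γ
  stop⇒cycle i d≡S | inj₂ (inj₂ (_ , _ , a , _ , d≡a , _)) with trans (sym d≡S) d≡a
  ...   | ()

  row-change⇒InSig : ∀ i j → ¬ (P S i (suc j) ≈P P S i j) → InSig S i
  row-change⇒InSig (suc i) j changes k k<1+i term =
    changes (≈P-trans (row (suc j)) (≈P-sym (row j)))
    where row = proj₂ (proj₂ (after-terminal term (ℕP.≤-pred k<1+i)))

  start-change⇒InSig : ∀ i → ¬ (P S (suc i) 0 ≈P Pinf S i) → InSig S (suc i)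
  start-change⇒InSig i changes k k<1+i term =
    changes (≈P-trans (proj₂ (proj₂ after) 0) (≈P-sym (proj₁ (proj₂ after))))
    where after = after-terminal term (ℕP.≤-pred k<1+i)

  edge⇒next≉Pinf : ∀ i {a} → d S i ≡ edge a → ¬ (P S (suc i) 0 ≈P Pinf S i)
  edge⇒next≉Pinf i d≡a P'≈P with round i
  ... | inj₁ (_ , _ , d≡T) = edge-¬terminal d≡a (inj₂ d≡T)
  ... | inj₂ (inj₁ (_ , _ , _ , d≡S)) = edge-¬terminal d≡a (inj₁ d≡S)
  ... | inj₂ (inj₂ (_ , _ , _ , _ , _ , inj₁ ((w , (_ , _ , _ , _ , ¬anti)) , P'≈))) =
    ¬anti (antiConn-star E (Pinf S i w) w cover)
    where
      cover : ∀ z → Pinf S i w z → _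
      cover z w~z with proj₁ P'≈ w z (proj₂ P'≈P w z w~z)
      ... | _ , (Y , Y⊆ , antiY , w∈ , z∈ , _) = (_∈ Y) , Y⊆ , w∈ , z∈ , antiY
  ... | inj₂ (inj₂ (_ , _ , _ , _ , _ , inj₂ ((w , (_ , _ , _ , _ , _ , ¬conn)) , P'≈))) =
    ¬conn λ x y w~x w~y → reach-widen (class⊆ Pinf.isEquivalence w~x)
      (proj₂ (proj₁ P'≈ x y (proj₂ P'≈P x y (Pinf.trans (Pinf.sym w~x) w~y))))
    where module Pinf = IsDecEquivalence (Pinf-isDecEquivalence i)

  -- beyond the limit index N of the 𝒫_{i,∞}, the partition 𝒫_{N+1,0} equals 𝒫_{N,∞}
  ∃-terminal : ∃[ ℓ ] Terminal (d S ℓ)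
  ∃-terminal = N , at-limit (d S N) refl
    where
      N = proj₁ Pinf-limit
      limit = proj₂ Pinf-limit
      at-limit : ∀ dN → d S N ≡ dN → Terminal (d S N)
      at-limit STOP d≡ = inj₁ d≡
      at-limit TERMINATE d≡ = inj₂ d≡
      at-limit (edge a) d≡ = ⊥-elim (edge⇒next≉Pinf N d≡
        (P-next-≤-Pinf N , ≤P-trans (proj₁ (limit N ℕP.≤-refl))
          (≤P-trans (proj₂ (limit (suc N) (ℕP.n≤1+n N))) (Pinf-≤-P (suc N) 0))))

  InSig⊎terminated : ∀ k → InSig S k ⊎ ∃[ k' ] (k' ℕ.< k × Terminal (d S k'))
  InSig⊎terminated zero = inj₁ λ _ ()
  InSig⊎terminated (suc k) with InSig⊎terminated k
  ... | inj₂ (k' , k'<k , term) = inj₂ (k' , ℕP.m≤n⇒m≤1+n k'<k , term)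
  ... | inj₁ inSig with terminal? (d S k)
  ...   | yes term = inj₂ (k , ℕP.≤-refl , term)
  ...   | no ¬term = inj₁ λ k' k'<1+k → case ℕP.m<1+n⇒m<n∨m≡n k'<1+k of λ where
          (inj₁ k'<k) → inSig k' k'<k
          (inj₂ refl) → ¬term

  ∃-first-terminal : ∃[ ℓ ] (Terminal (d S ℓ) × InSig S ℓ)
  ∃-first-terminal = go _ (proj₁ ∃-terminal) ℕP.≤-refl (proj₂ ∃-terminal)
    where
      go : ∀ bound k → k ℕ.< bound → Terminal (d S k) → ∃[ ℓ ] (Terminal (d S ℓ) × InSig S ℓ)
      go (suc bound) k (s≤s k≤bound) term with InSig⊎terminated k
      ... | inj₁ inSig = k , term , inSig
      ... | inj₂ (k' , k'<k , term') = go bound k' (ℕP.≤-trans k'<k k≤bound) term'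

-- Exposure steps and signatures

<T-trans : ∀ {p q r} → p <T q → q <T r → p <T r
<T-trans (ff1 a) (ff1 b) = ff1 (ℕP.<-trans a b)
<T-trans (ff1 a) (ff2 b) = ff1 a
<T-trans (ff1 a) (fi b) = fi (ℕP.<⇒≤ (ℕP.<-≤-trans a b))
<T-trans (ff1 a) f∞ = f∞
<T-trans (ff2 a) (ff1 b) = ff1 b
<T-trans (ff2 a) (ff2 b) = ff2 (ℕP.<-trans a b)
<T-trans (ff2 a) (fi b) = fi b
<T-trans (ff2 a) f∞ = f∞
<T-trans (fi a) (if b) = ff1 (ℕP.≤-<-trans a b)
<T-trans (fi a) (ii b) = fi (ℕP.<⇒≤ (ℕP.≤-<-trans a b))
<T-trans (fi a) i∞ = f∞
<T-trans (if a) (ff1 b) = if (ℕP.<-trans a b)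
<T-trans (if a) (ff2 b) = if a
<T-trans (if a) (fi b) = ii (ℕP.<-≤-trans a b)
<T-trans (if a) f∞ = i∞
<T-trans (ii a) (if b) = if (ℕP.<-trans a b)
<T-trans (ii a) (ii b) = ii (ℕP.<-trans a b)
<T-trans (ii a) i∞ = i∞

<-≤T-trans : ∀ {p q r} → p <T q → q ≤T r → p <T r
<-≤T-trans p<q (inj₁ q<r) = <T-trans p<q q<r
<-≤T-trans p<q (inj₂ refl) = p<q

≤T⊎>T : ∀ p q → (p ≤T q) ⊎ (q <T p)
≤T⊎>T (fin i j) (fin i' j') with ℕP.<-cmp i i'
... | tri< i<i' _ _ = inj₁ (inj₁ (ff1 i<i'))
... | tri> _ _ i>i' = inj₂ (ff1 i>i')
... | tri≈ _ refl _ with ℕP.<-cmp j j'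
...   | tri< j<j' _ _ = inj₁ (inj₁ (ff2 j<j'))
...   | tri≈ _ refl _ = inj₁ (inj₂ refl)
...   | tri> _ _ j>j' = inj₂ (ff2 j>j')
≤T⊎>T (fin i j) (inf i') with ℕP.≤-<-connex i i'
... | inj₁ i≤i' = inj₁ (inj₁ (fi i≤i'))
... | inj₂ i'<i = inj₂ (if i'<i)
≤T⊎>T (fin i j) infinf = inj₁ (inj₁ f∞)
≤T⊎>T (inf i) (fin i' j') with ℕP.≤-<-connex i' i
... | inj₁ i'≤i = inj₂ (fi i'≤i)
... | inj₂ i<i' = inj₁ (inj₁ (if i<i'))
≤T⊎>T (inf i) (inf i') with ℕP.<-cmp i i'
... | tri< i<i' _ _ = inj₁ (inj₁ (ii i<i'))
... | tri≈ _ refl _ = inj₁ (inj₂ refl)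
... | tri> _ _ i>i' = inj₂ (ii i>i')
≤T⊎>T (inf i) infinf = inj₁ (inj₁ i∞)
≤T⊎>T infinf (fin i j) = inj₂ f∞
≤T⊎>T infinf (inf i) = inj₂ i∞
≤T⊎>T infinf infinf = inj₁ (inj₂ refl)

AgreeUpTo : ∀ {n m} → Seq n m → Seq n m → ℕ → Set
AgreeUpTo S S' i = ∀ q → q ≤T inf i → At S q ≈P At S' q

AgreeUpTo-sym : ∀ {n m} {S S' : Seq n m} {i} → AgreeUpTo S S' i → AgreeUpTo S' S i
AgreeUpTo-sym agree q q≤ = ≈P-sym (agree q q≤)

-- pairs split by 𝒫_{i,∞} are exposed at a step up to (i,∞), where S and S' agree
expStep-transport : ∀ {n m} {S S' : Seq n m} i → AgreeUpTo S S' i → ∀ x y p → ¬ Pinf S i x y →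
  ExpStep S x y p → ExpStep S' x y p
expStep-transport i agree x y p ¬xy (¬At , below) with ≤T⊎>T p (inf i)
... | inj₂ i<p = ⊥-elim (¬xy (below (inf i) i<p))
... | inj₁ p≤i = (λ At' → ¬At (proj₂ (agree p p≤i) x y At')) ,
                 λ q q<p → proj₁ (agree q (inj₁ (<-≤T-trans q<p p≤i))) x y (below q q<p)

<Pos-trichotomous : ∀ (p q : ℕ × Tag) → (p <Pos q) ⊎ (p ≡ q) ⊎ (q <Pos p)
<Pos-trichotomous (i , s) (i' , s') with ℕP.<-cmp i i'
... | tri< i<i' _ _ = inj₁ (lt-i i<i')
... | tri> _ _ i>i' = inj₂ (inj₂ (lt-i i>i'))
... | tri≈ _ refl _ = tags s s'
  where
    tags : ∀ s s' → ((i , s) <Pos (i , s')) ⊎ ((i , s) ≡ (i , s')) ⊎ ((i , s') <Pos (i , s))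
    tags (pj j) (pj j') with ℕP.<-cmp j j'
    ... | tri< j<j' _ _ = inj₁ (lt-jj j<j')
    ... | tri≈ _ refl _ = inj₂ (inj₁ refl)
    ... | tri> _ _ j>j' = inj₂ (inj₂ (lt-jj j>j'))
    tags (pj j) p∞ = inj₁ lt-j∞
    tags (pj j) dd = inj₁ lt-jd
    tags p∞ (pj j) = inj₂ (inj₂ lt-j∞)
    tags p∞ p∞ = inj₂ (inj₁ refl)
    tags p∞ dd = inj₁ lt-∞d
    tags dd (pj j) = inj₂ (inj₂ lt-jd)
    tags dd p∞ = inj₂ (inj₂ lt-∞d)
    tags dd dd = inj₂ (inj₁ refl)

module _ {n m : ℕ} (rank : D m → ℕ) where

  EqAt-sym : ∀ {S₁ S₂ : Seq n m} p → EqAt S₁ S₂ p → EqAt S₂ S₁ p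
  EqAt-sym (i , pj j) = ≈P-sym
  EqAt-sym (i , p∞) = ≈P-sym
  EqAt-sym (i , dd) = sym

  EqAt⇒¬LtAt : ∀ {S₁ S₂ : Seq n m} p → EqAt S₁ S₂ p → ¬ LtAt rank S₁ S₂ p
  EqAt⇒¬LtAt (i , pj j) eq (_ , ¬eq) = ¬eq eq
  EqAt⇒¬LtAt (i , p∞) eq (_ , ¬eq) = ¬eq eq
  EqAt⇒¬LtAt (i , dd) eq lt = ℕP.<-irrefl (cong rank eq) lt

  LtAt-asym : ∀ {S₁ S₂ : Seq n m} p → LtAt rank S₁ S₂ p → ¬ LtAt rank S₂ S₁ p
  LtAt-asym (i , pj j) (≤ , ¬eq) (≥ , _) = ¬eq (≤ , ≥)
  LtAt-asym (i , p∞) (≤ , ¬eq) (≥ , _) = ¬eq (≤ , ≥)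
  LtAt-asym (i , dd) = ℕP.<-asym

  FirstDiffLt : Seq n m → Seq n m → Set
  FirstDiffLt S S' = ∃[ p ] (InSig S (proj₁ p) × InSig S' (proj₁ p)
                     × (∀ q → q <Pos p → EqAt S S' q) × LtAt rank S S' p)

  FirstDiffLt⇒SigLt : ∀ {S S' : Seq n m} → FirstDiffLt S S' → SigLt rank S S'
  FirstDiffLt⇒SigLt {S} {S'} diff@(p , inSig , inSig' , below , lt) = inj₂ diff , ¬SigLe
    where
      ¬SigLe : ¬ SigLe rank S' S
      ¬SigLe (inj₁ equal) = EqAt⇒¬LtAt p (EqAt-sym p (equal p inSig')) lt
      ¬SigLe (inj₂ (p' , _ , _ , below' , lt')) with <Pos-trichotomous p p'
      ... | inj₁ p<p' = EqAt⇒¬LtAt p (EqAt-sym p (below' p p<p')) lt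
      ... | inj₂ (inj₁ refl) = LtAt-asym p lt lt'
      ... | inj₂ (inj₂ p'<p) = EqAt⇒¬LtAt p' (EqAt-sym p' (below p' p'<p)) lt'

-- From π to π - e

∈-⊖-⊖ : ∀ {n m} (ρ : QG n m) a b f z → z ∈ ((ρ ⊖ a) ⊖ b) f → z ∈ ((ρ ⊖ b) ⊖ a) f
∈-⊖-⊖ ρ a b f z z∈ =
  ∈-⊖⁺ (ρ ⊖ b) a f (∈-⊖⇒≢ ρ a f z∈a) (∈-⊖⁺ ρ b f (∈-⊖⇒≢ (ρ ⊖ a) b f z∈) (∈-⊖⁻ ρ a f z∈a))
  where z∈a = ∈-⊖⁻ (ρ ⊖ a) b f z∈

module Deletion {n m} (E : Fin m → Subset n) (π : QG n m) (isQG : IsQuasigraph E π) (e : Fin m)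
                (X : Subset n) (πe⊆X : π e ⊆ X) (σ-conn : ConnOn (π ⊖ e) (_∈ X)) where

  σ : QG n m
  σ = π ⊖ e

  σ⊆π : ∀ f z → z ∈ σ f → z ∈ π f
  σ⊆π f z = ∈-⊖⁻ π e f

  used-σ⇒π : ∀ {a} → Used σ a → Used π a
  used-σ⇒π (z , z∈) = z , σ⊆π _ z z∈

  used-π⇒σ : ∀ {a} → e ≢ a → Used π a → Used σ a
  used-π⇒σ e≢a (z , z∈) = z , ∈-⊖⁺ π e _ e≢a z∈

  σ-path : ∀ {Q : Part n} {x y z} → WithinClass Q X → y ∈ π e → z ∈ π e → Q x y → Reach σ (Q x) y z
  σ-path within y∈ z∈ x~y = reach-widen (λ w w∈ → within _ _ w (πe⊆X y∈) w∈ x~y) (σ-conn _ _ (πe⊆X y∈) (πe⊆X z∈))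

  reach-σ : ∀ {Q : Part n} → WithinClass Q X → ∀ x {s t} → Reach π (Q x) s t → Reach σ (Q x) s t
  reach-σ within x = reach-⊖-bypass e λ y z y∈ z∈ x~y _ → σ-path within y∈ z∈ x~y

  compRef-π≈σ : ∀ {Q : Part n} → WithinClass Q X → CompRef π Q ≈P CompRef σ Q
  compRef-π≈σ within = (λ x y (q , r) → q , reach-σ within x r) ,
                       (λ x y (q , r) → q , reach-map (λ z p → p) σ⊆π r)

  antiRef-π≤σ : ∀ {keep} (keep? : ∀ f → Dec (keep f)) {Q : Part n} → IsDecEquivalence Q →
    AntiRef E keep π Q ≤P AntiRef E keep σ Q
  antiRef-π≤σ keep? isDecEq x y (q , s) = q , sameAnti-mono E keep? _ (x Q.≟_) σ⊆π s
    where module Q = IsDecEquivalence isDecEq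

  unused-π⇒σ : ∀ {P P' : Part n} → P ≈P P' → ∀ a → ¬ Crossing P (π a) → ¬ Crossing P' (σ a)
  unused-π⇒σ (P≤P' , _) a ¬crossing (x , y , x∈ , y∈ , ¬xy) =
    ¬crossing (x , y , σ⊆π a x x∈ , σ⊆π a y y∈ , λ xy → ¬xy (P≤P' x y xy))

  unused-σ⇒π : ∀ {P P' : Part n} → WithinClass P X → IsEquivalence P → P ≈P P' →
               ∀ a → ¬ Crossing P' (σ a) → ¬ Crossing P (π a)
  unused-σ⇒π within isEq (_ , P'≤P) a ¬crossing (x , y , x∈ , y∈ , ¬xy) = by-cases (e Fin.≟ a)
    where
      by-cases : Dec (e ≡ a) → Empty
      by-cases (yes refl) = ¬xy (within x x y (πe⊆X x∈) (πe⊆X y∈) (IsEquivalence.refl isEq))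
      by-cases (no e≢a) = ¬crossing (x , y , ∈-⊖⁺ π e a e≢a x∈ , ∈-⊖⁺ π e a e≢a y∈ , λ xy → ¬xy (P'≤P x y xy))

  ¬xBridge-e : ∀ {Q : Part n} → WithinClass Q X → ∀ w → ¬ XBridge E π e (Q w)
  ¬xBridge-e within w (conn , _ , _ , _ , _ , ¬conn) = ¬conn λ x y wx wy → reach-σ within w (conn x y wx wy)

  -- a bridge a of π stays a bridge of σ with the same components: a σ-path through a
  -- between the ends of π(e) would, together with e, reconnect π - a on the class of a
  reach-σ⊖ : ∀ {Q : Part n} → IsEquivalence Q → WithinClass Q X → ∀ {a} → e ≢ a → ∀ w → XBridge E π a (Q w) →
    ∀ x {s t} → Reach (π ⊖ a) (Q x) s t → Reach (σ ⊖ a) (Q x) s t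
  reach-σ⊖ {Q} isEq within {a} e≢a w (conn , _ , _ , (p₀ , p₀∈) , a⊆w , ¬conn) x r =
    reach-map (λ z z∈ → z∈) (∈-⊖-⊖ π a e) (reach-⊖-bypass e bypass r)
    where
      module Q = IsEquivalence isEq
      ∣πa∣≡2 : ∣ π a ∣ ≡ 2
      ∣πa∣≡2 with proj₂ (isQG a)
      ... | inj₁ ∣πa∣≡2 = ∣πa∣≡2
      ... | inj₂ πa≡∅ = ⊥-elim (SubP.∉⊥ (subst (p₀ ∈_) πa≡∅ p₀∈))
      to-π⊖a : ∀ {Y u v} → Reach (σ ⊖ a) Y u v → Reach (π ⊖ a) Y u v
      to-π⊖a = reach-map (λ z z∈ → z∈) (λ f z z∈ → ∈-⊖⁺ π a f (∈-⊖⇒≢ σ a f z∈) (σ⊆π f z (∈-⊖⁻ σ a f z∈)))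
      bypass : ∀ y z → y ∈ (π ⊖ a) e → z ∈ (π ⊖ a) e → Q x y → Q x z → Reach ((π ⊖ a) ⊖ e) (Q x) y z
      bypass y z y∈ z∈ x~y x~z with reach-⊖-split a (σ-path within (∈-⊖⁻ π a e y∈) (∈-⊖⁻ π a e z∈) x~y)
      ... | inj₁ r' = reach-map (λ z z∈ → z∈) (∈-⊖-⊖ π e a) r'
      ... | inj₂ (p , q , p∈ , q∈ , y~p , q~z) with p Fin.≟ q
      ...   | yes refl = reach-map (λ z z∈ → z∈) (∈-⊖-⊖ π e a) (reach-trans y~p q~z)
      ...   | no p≢q = ⊥-elim (¬conn (connOn-⊖ ∣πa∣≡2 (σ⊆π a p p∈) (σ⊆π a q q∈) p≢q p~q conn))
        where
          w~ : ∀ v → Q x v → Q w v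
          w~ v x~v = Q.trans (a⊆w p (σ⊆π a p p∈)) (Q.trans (Q.sym (reach-target y~p)) x~v)
          p~q : Reach (π ⊖ a) (Q w) p q
          p~q = reach-widen w~ (reach-trans (reach-trans (to-π⊖a (reach-sym y~p)) (step e (here x~y) y∈ z∈ x~z))
                                            (to-π⊖a (reach-sym q~z)))

  -- the now unused e witnesses that the two ends of π(e) cannot be separated
  antiRef-σ-joins : ∀ {keep} (keep? : ∀ f → Dec (keep f)) → keep e → (Q : Part n) → IsDecEquivalence Q →
    ∀ {u v} → u ∈ π e → v ∈ π e → Q u v → AntiRef E keep σ Q u v
  antiRef-σ-joins keep? keep-e Q isDecEq {u} {v} u∈ v∈ u~v =
    u~v , antiConn⇒sameAnti E keep? σ (Q u) (u Q.≟_) (⁅ u ⁆ ∪ ⁅ v ⁆) pair⊆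
      (antiConn-pair E keep-e (λ z z∈ → ∈-⊖⇒≢ π e e z∈ refl) (proj₁ (isQG e) u∈) (proj₁ (isQG e) v∈))
      (SubP.x∈p∪q⁺ (inj₁ (SubP.x∈⁅x⁆ u))) (SubP.x∈p∪q⁺ (inj₂ (SubP.x∈⁅x⁆ v)))
    where
      module Q = IsDecEquivalence isDecEq
      pair⊆ : ∀ z → z ∈ ⁅ u ⁆ ∪ ⁅ v ⁆ → Q u z
      pair⊆ z z∈ with SubP.x∈p∪q⁻ ⁅ u ⁆ ⁅ v ⁆ z∈
      ... | inj₁ z∈⁅u⁆ = subst (Q u) (sym (SubP.x∈⁅y⁆⇒x≡y u z∈⁅u⁆)) Q.refl
      ... | inj₂ z∈⁅v⁆ = subst (Q u) (sym (SubP.x∈⁅y⁆⇒x≡y v z∈⁅v⁆)) u~v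

  compRef-σ-joins : ∀ {Q : Part n} → IsEquivalence Q → WithinClass Q X →
    ∀ {u v} → u ∈ π e → v ∈ π e → Q u v → CompRef σ Q u v
  compRef-σ-joins isEq within u∈ v∈ u~v = u~v , σ-path within u∈ v∈ (IsEquivalence.refl isEq)

  refine-σ-joins : ∀ j {Q : Part n} → IsDecEquivalence Q → WithinClass Q X →
    ∀ {u v} → u ∈ π e → v ∈ π e → Q u v → Refine E σ j Q u v
  refine-σ-joins zero isDecEq = compRef-σ-joins (IsDecEquivalence.isEquivalence isDecEq)
  refine-σ-joins (suc zero) isDecEq _ = antiRef-σ-joins keepAll? tt _ isDecEq
  refine-σ-joins (suc (suc j)) = refine-σ-joins j

module Comparison {n m} (E : Fin m → Subset n) (π : QG n m) (isQG : IsQuasigraph E π) (e : Fin m)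
                  (X : Subset n) (πe⊆X : π e ⊆ X) (σ-conn : ConnOn (π ⊖ e) (_∈ X))
                  (rank : D m → ℕ) (dord : DOrder rank)
                  (S S' : Seq n m) (ps : PlaneSeq E π S) (ps' : PlaneSeq E (π ⊖ e) S') where
  open Deletion E π isQG e X πe⊆X σ-conn public
  module A = PlaneSeqProperties E π S ps
  module B = PlaneSeqProperties E σ S' ps'
  open ≤P-Reasoning
  open RawMonad (Data.Sum.Effectful.Left.monad (FirstDiffLt rank S S') 0ℓ) using (pure; _>>=_)

  edge<STOP : ∀ a → rank (edge a) ℕ.< rank STOP
  edge<STOP = proj₂ (proj₂ dord)

  AgreeBefore : ℕ → Set
  AgreeBefore i = ∀ q → proj₁ q ℕ.< i → EqAt S S' q

  InSig-transport : ∀ {i} → AgreeBefore i → InSig S i → InSig S' i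
  InSig-transport agree inSig k k<i term = inSig k k<i (subst Terminal (sym (agree (k , dd) k<i)) term)

  below-row : ∀ {i j} → AgreeBefore i → (∀ j' → j' ℕ.< j → P S i j' ≈P P S' i j') →
              ∀ q → q <Pos (i , pj j) → EqAt S S' q
  below-row agree row q (lt-i q<i) = agree q q<i
  below-row agree row (_ , pj j') (lt-jj j'<j) = row j' j'<j

  settle : ∀ i j → (∀ q → q <Pos (i , pj j) → EqAt S S' q) → InSig S i →
           P S i j ≤P P S' i j → FirstDiffLt rank S S' ⊎ (P S i j ≈P P S' i j)
  settle i j below inSig ≤ with ≤P? (IsDecEquivalence._≟_ (B.P-isDecEquivalence i j))
                                     (IsDecEquivalence._≟_ (A.P-isDecEquivalence i j))
  ... | yes ≥ = inj₂ (≤ , ≥)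
  ... | no ≱ = inj₁ ((i , pj j) , inSig , InSig-transport (λ q q<i → below q (lt-i q<i)) inSig ,
                     below , ≤ , λ ≈ → ≱ (proj₂ ≈))

  refine-step-≤ : ∀ i j → P S i j ≈P P S' i j → WithinClass (P S i j) X → P S i (suc j) ≤P P S' i (suc j)
  refine-step-≤ i j P≈ within with refine-view E j
  ... | inj₁ comp = begin
    P S i (suc j)            ≈⟨ A.P-step i j ⟩
    Refine E π j (P S i j)   ≡⟨ comp π _ ⟩
    CompRef π (P S i j)      ≈⟨ compRef-π≈σ within ⟩
    CompRef σ (P S i j)      ≈⟨ compRef-cong σ P≈ ⟩
    CompRef σ (P S' i j)     ≡⟨ comp σ _ ⟨
    Refine E σ j (P S' i j)  ≈⟨ B.P-step i j ⟨
    P S' i (suc j)           ∎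
  ... | inj₂ anti = begin
    P S i (suc j)                ≈⟨ A.P-step i j ⟩
    Refine E π j (P S i j)       ≡⟨ anti π _ ⟩
    AntiRef E AllE π (P S i j)   ≲⟨ antiRef-π≤σ keepAll? (A.P-isDecEquivalence i j) ⟩
    AntiRef E AllE σ (P S i j)   ≈⟨ antiRef-cong E σ P≈ ⟩
    AntiRef E AllE σ (P S' i j)  ≡⟨ anti σ _ ⟨
    Refine E σ j (P S' i j)      ≈⟨ B.P-step i j ⟨
    P S' i (suc j)               ∎

  row-agrees : ∀ i → AgreeBefore i → InSig S i → P S i 0 ≈P P S' i 0 →
    ∀ j → (∀ j' → j' ℕ.< j → WithinClass (P S i j') X) →
    FirstDiffLt rank S S' ⊎ (∀ j' → j' ℕ.≤ j → P S i j' ≈P P S' i j')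
  row-agrees i agree inSig P₀≈ zero within = pure λ { .zero z≤n → P₀≈ }
  row-agrees i agree inSig P₀≈ (suc j) within = do
    row ← row-agrees i agree inSig P₀≈ j (λ j' j'<j → within j' (ℕP.m≤n⇒m≤1+n j'<j))
    P≈ ← settle i (suc j) (below-row agree (λ j' j'<1+j → row j' (ℕP.≤-pred j'<1+j))) inSig
           (refine-step-≤ i j (row j ℕP.≤-refl) (within j ℕP.≤-refl))
    pure λ j' j'≤1+j → case ℕP.m≤n⇒m<n∨m≡n j'≤1+j of λ where
      (inj₁ j'<1+j) → row j' (ℕP.≤-pred j'<1+j)
      (inj₂ refl) → P≈

  whole-row-agrees : ∀ i → AgreeBefore i → InSig S i → P S i 0 ≈P P S' i 0 → (∀ j → WithinClass (P S i j) X) →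
    FirstDiffLt rank S S' ⊎ ((∀ j → P S i j ≈P P S' i j) × (Pinf S i ≈P Pinf S' i))
  whole-row-agrees i agree inSig P₀≈ within = do
    row ← row-agrees i agree inSig P₀≈ N (λ j _ → within j)
    let Pinf≈ = ≈P-trans (≈P-sym (limA N (ℕP.m≤m+n NA NB))) (≈P-trans (row N ℕP.≤-refl) (limB N (ℕP.m≤n+m NB NA)))
    pure ((λ j → case ℕP.≤-<-connex j N of λ where
            (inj₁ j≤N) → row j j≤N
            (inj₂ N<j) → ≈P-trans (limA j (ℕP.≤-trans (ℕP.m≤m+n NA NB) (ℕP.<⇒≤ N<j)))
                           (≈P-trans Pinf≈ (≈P-sym (limB j (ℕP.≤-trans (ℕP.m≤n+m NB NA) (ℕP.<⇒≤ N<j)))))) ,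
          Pinf≈)
    where
      NA = proj₁ (A.row-limit i)
      NB = proj₁ (B.row-limit i)
      N = NA + NB
      limA = proj₂ (A.row-limit i)
      limB = proj₂ (B.row-limit i)

  agreeUpTo : ∀ i → AgreeBefore i → (∀ j → P S i j ≈P P S' i j) → Pinf S i ≈P Pinf S' i → AgreeUpTo S S' i
  agreeUpTo i agree row Pinf≈ (fin i' j) (inj₁ (fi i'≤i)) with ℕP.m≤n⇒m<n∨m≡n i'≤i
  ... | inj₁ i'<i = agree (i' , pj j) i'<i
  ... | inj₂ refl = row j
  agreeUpTo i agree row Pinf≈ (inf i') (inj₁ (ii i'<i)) = agree (i' , p∞) i'<i
  agreeUpTo i agree row Pinf≈ (inf .i) (inj₂ refl) = Pinf≈

  -- Once round i agrees up to 𝒫_{i,∞}, π and σ choose the same leading hyperedge.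
  module AtRoundEnd (i : ℕ) (Pinf≈ : Pinf S i ≈P Pinf S' i) (within : WithinClass (Pinf S i) X)
                    (agree : AgreeUpTo S S' i) where

    private
      isDecEq = A.Pinf-isDecEquivalence i
      isEq = IsDecEquivalence.isEquivalence isDecEq

    cycle-π⇒σ : QCyc E π (Pinf S i) → QCyc E σ (Pinf S' i)
    cycle-π⇒σ = qCyc-map E Pinf≈ (unused-π⇒σ Pinf≈)

    cycle-σ⇒π : QCyc E σ (Pinf S' i) → QCyc E π (Pinf S i)
    cycle-σ⇒π = qCyc-map E (≈P-sym Pinf≈) (unused-σ⇒π within isEq Pinf≈)

    inL-π⇒σ : ∀ {b} → InL E π S (Pinf S i) b → InL E σ S' (Pinf S' i) b
    inL-π⇒σ = inL-map E Pinf≈ (unused-π⇒σ Pinf≈) (expStep-transport i agree)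
      (λ x y p ¬xy → expStep-transport i (AgreeUpTo-sym agree) x y p (λ xy → ¬xy (proj₂ Pinf≈ x y xy)))

    inL-σ⇒π : ∀ {b} → InL E σ S' (Pinf S' i) b → InL E π S (Pinf S i) b
    inL-σ⇒π = inL-map E (≈P-sym Pinf≈) (unused-σ⇒π within isEq Pinf≈) (expStep-transport i (AgreeUpTo-sym agree))
      (λ x y p ¬xy → expStep-transport i agree x y p (λ xy → ¬xy (proj₁ Pinf≈ x y xy)))

    e≢bridge : ∀ {a} w → XBridge E π a (Pinf S i w) → e ≢ a
    e≢bridge w bridge refl = ¬xBridge-e within w bridge

    cut-≤ : ∀ {a} → RoundCut E π S i a → RoundCut E σ S' i a → P S (suc i) 0 ≤P P S' (suc i) 0
    cut-≤ {a} (inj₁ (_ , P'≈)) (inj₁ (_ , P''≈)) = begin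
      P S (suc i) 0                   ≈⟨ P'≈ ⟩
      AntiRef E (_≢ a) π (Pinf S i)   ≲⟨ antiRef-π≤σ (keepOthers? a) isDecEq ⟩
      AntiRef E (_≢ a) σ (Pinf S i)   ≈⟨ antiRef-cong E σ Pinf≈ ⟩
      AntiRef E (_≢ a) σ (Pinf S' i)  ≈⟨ P''≈ ⟨
      P S' (suc i) 0                  ∎
    cut-≤ (inj₁ ((_ , antibridge) , _)) (inj₂ ((_ , bridge) , _)) =
      ⊥-elim (xAntibridge-unused E antibridge (used-σ⇒π (xBridge-used E bridge)))
    cut-≤ (inj₂ ((w , bridge) , _)) (inj₁ ((_ , antibridge) , _)) =
      ⊥-elim (xAntibridge-unused E antibridge (used-π⇒σ (e≢bridge w bridge) (xBridge-used E bridge)))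
    cut-≤ {a} (inj₂ ((w , bridge) , P'≈)) (inj₂ (_ , P''≈)) = begin
      P S (suc i) 0                ≈⟨ P'≈ ⟩
      CompRef (π ⊖ a) (Pinf S i)   ≲⟨ (λ x y (x~y , r) → x~y , reach-σ⊖ isEq within (e≢bridge w bridge) w bridge x r) ⟩
      CompRef (σ ⊖ a) (Pinf S i)   ≈⟨ compRef-cong (σ ⊖ a) Pinf≈ ⟩
      CompRef (σ ⊖ a) (Pinf S' i)  ≈⟨ P''≈ ⟨
      P S' (suc i) 0               ∎

    round-compare : d S i ≢ STOP →
      (d S i ≡ d S' i × P S (suc i) 0 ≤P P S' (suc i) 0) ⊎ (rank (d S i) ℕ.< rank (d S' i))
    round-compare ¬stop with A.round i | B.round i
    ... | inj₂ (inj₁ (_ , _ , _ , d≡S)) | _ = ⊥-elim (¬stop d≡S)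
    ... | inj₁ (_ , P'≈ , d≡T) | inj₁ (_ , P''≈ , d'≡T) =
      inj₁ (trans d≡T (sym d'≡T) , ≤P-trans (proj₁ P'≈) (≤P-trans (proj₁ Pinf≈) (proj₂ P''≈)))
    ... | inj₁ (∄γ , _) | inj₂ (inj₁ (γ , _)) = ⊥-elim (∄γ (cycle-σ⇒π γ))
    ... | inj₁ (∄γ , _) | inj₂ (inj₂ (γ , _)) = ⊥-elim (∄γ (cycle-σ⇒π γ))
    ... | inj₂ (inj₂ (γ , _)) | inj₁ (∄γ , _) = ⊥-elim (∄γ (cycle-π⇒σ γ))
    ... | inj₂ (inj₂ (_ , _ , a , _ , d≡a , _)) | inj₂ (inj₁ (_ , _ , _ , d'≡S)) =
      inj₂ (subst₂ (λ u v → rank u ℕ.< rank v) (sym d≡a) (sym d'≡S) (edge<STOP a))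
    ... | inj₂ (inj₂ (_ , _ , a , (a∈L , a-max) , d≡a , cut))
        | inj₂ (inj₂ (_ , _ , a' , (a'∈L , a'-max) , d'≡a' , cut'))
        with FinP.≤-antisym (a-max a' (inL-σ⇒π a'∈L)) (a'-max a (inL-π⇒σ a∈L))
    ...   | refl = inj₁ (trans d≡a (sym d'≡a') , cut-≤ cut cut')

  Comparable : ℕ → Set
  Comparable i = (∀ j → WithinClass (P S i j) X) × WithinClass (Pinf S i) X × (d S i ≢ STOP)

  round-agrees : ∀ i → AgreeBefore i → InSig S i → P S i 0 ≈P P S' i 0 → Comparable i →
    FirstDiffLt rank S S' ⊎ (AgreeBefore (suc i) × P S (suc i) 0 ≤P P S' (suc i) 0)
  round-agrees i agree inSig P₀≈ (within , withinInf , ¬stop) = do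
    row , Pinf≈ ← whole-row-agrees i agree inSig P₀≈ within
    case AtRoundEnd.round-compare i Pinf≈ withinInf (agreeUpTo i agree row Pinf≈) ¬stop of λ where
      (inj₂ d<) → inj₁ ((i , dd) , inSig , InSig-transport agree inSig , below row Pinf≈ , d<)
      (inj₁ (d≡ , P'≤)) → pure (extend row Pinf≈ d≡ , P'≤)
    where
      below : (∀ j → P S i j ≈P P S' i j) → Pinf S i ≈P Pinf S' i → ∀ q → q <Pos (i , dd) → EqAt S S' q
      below row Pinf≈ q (lt-i q<i) = agree q q<i
      below row Pinf≈ (_ , pj j) lt-jd = row j
      below row Pinf≈ (_ , p∞) lt-∞d = Pinf≈
      extend : (∀ j → P S i j ≈P P S' i j) → Pinf S i ≈P Pinf S' i → d S i ≡ d S' i → AgreeBefore (suc i)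
      extend row Pinf≈ d≡ q q<1+i with ℕP.m<1+n⇒m<n∨m≡n q<1+i
      extend row Pinf≈ d≡ q _ | inj₁ q<i = agree q q<i
      extend row Pinf≈ d≡ (_ , pj j) _ | inj₂ refl = row j
      extend row Pinf≈ d≡ (_ , p∞) _ | inj₂ refl = Pinf≈
      extend row Pinf≈ d≡ (_ , dd) _ | inj₂ refl = d≡

  rounds-agree : ∀ i → InSig S i → (∀ i' → i' ℕ.< i → Comparable i') →
    FirstDiffLt rank S S' ⊎ (AgreeBefore i × P S i 0 ≈P P S' i 0)
  rounds-agree zero inSig comparable = pure ((λ q ()) , ≈P-trans A.P₀₀≈Full (≈P-sym B.P₀₀≈Full))
  rounds-agree (suc i) inSig comparable = do
    agree , P₀≈ ← rounds-agree i (InSig-pred {S = S} inSig) (λ i' i'<i → comparable i' (ℕP.m≤n⇒m≤1+n i'<i))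
    agree' , P'≤ ← round-agrees i agree (InSig-pred {S = S} inSig) P₀≈ (comparable i ℕP.≤-refl)
    P'≈ ← settle (suc i) 0 (λ { q (lt-i q<1+i) → agree' q q<1+i }) inSig P'≤
    pure (agree' , P'≈)

  σ-cut-joins : ∀ i {a} → e ≢ a → ¬ Used π a → d S' i ≡ edge a →
    ∀ {u v} → u ∈ π e → v ∈ π e → Pinf S' i u v → P S' (suc i) 0 u v
  σ-cut-joins i {a} e≢a unused d'≡a {u} {v} u∈ v∈ u~v with B.row-start i
  ... | inj₁ P'≈ = proj₂ P'≈ u v u~v
  ... | inj₂ (a' , d'≡a' , cut) with trans (sym d'≡a) d'≡a'
  ...   | refl with cut
  ...     | inj₁ (_ , P'≈) =
            proj₂ P'≈ u v (antiRef-σ-joins (keepOthers? a) e≢a _ (B.Pinf-isDecEquivalence i) u∈ v∈ u~v)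
  ...     | inj₂ ((_ , bridge) , _) = ⊥-elim (unused (used-σ⇒π (xBridge-used E bridge)))

  module _ {R : Part n} (isEqR : IsEquivalence R) (cls : IsClass R X) where

    comparable-below-class : ∀ i → R ≤P Pinf S i → d S i ≢ STOP → Comparable i
    comparable-below-class i R≤Pinf ¬stop =
      (λ j → class⇒withinClass isEqR (isEq-P i j) cls (≤P-trans R≤Pinf (A.Pinf-≤-P i j))) ,
      class⇒withinClass isEqR (IsDecEquivalence.isEquivalence (A.Pinf-isDecEquivalence i)) cls R≤Pinf ,
      ¬stop
      where isEq-P = λ i j → IsDecEquivalence.isEquivalence (A.P-isDecEquivalence i j)

  split-in-row : ∀ i j {u v} → u ∈ π e → v ∈ π e → ¬ P S i (suc j) u v → IsClass (P S i j) X →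
                 FirstDiffLt rank S S'
  split-in-row i j {u} {v} u∈ v∈ split cls = reduce do
    agree , P₀≈ ← rounds-agree i inSig comparable
    row ← row-agrees i agree inSig P₀≈ j (λ j' j'<j → within j' (ℕP.<⇒≤ j'<j))
    let P≈ = row j ℕP.≤-refl
    pure ((i , pj (suc j)) , inSig , InSig-transport agree inSig ,
          below-row agree (λ j' j'<1+j → row j' (ℕP.≤-pred j'<1+j)) ,
          refine-step-≤ i j P≈ (within j ℕP.≤-refl) ,
          λ P'≈ → split (proj₂ P'≈ u v (joined-in-σ P≈)))
    where
      isEq : ∀ j → IsEquivalence (P S i j)
      isEq j = IsDecEquivalence.isEquivalence (A.P-isDecEquivalence i j)
      u~v : P S i j u v
      u~v = class-related (isEq j) cls (πe⊆X u∈) (πe⊆X v∈)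
      inSig : InSig S i
      inSig = A.row-change⇒InSig i j (λ P'≈ → split (proj₂ P'≈ u v u~v))
      comparable : ∀ i' → i' ℕ.< i → Comparable i'
      comparable i' i'<i =
        comparable-below-class (isEq j) cls i' (A.P-later-≤-Pinf i'<i j) (λ d≡S → inSig i' i'<i (inj₁ d≡S))
      within : ∀ j' → j' ℕ.≤ j → WithinClass (P S i j') X
      within j' j'≤j = class⇒withinClass (isEq j) (isEq j') cls (A.P-antitone i j'≤j)
      joined-in-σ : P S i j ≈P P S' i j → P S' i (suc j) u v
      joined-in-σ P≈ = proj₂ (B.P-step i j) u v
        (refine-σ-joins j (B.P-isDecEquivalence i j) (withinClass-resp P≈ (within j ℕP.≤-refl)) u∈ v∈
          (proj₁ P≈ u v u~v))

  split-at-cut : Used π e → ∀ i {u v} → u ∈ π e → v ∈ π e → ¬ P S (suc i) 0 u v → IsClass (Pinf S i) X →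
                 FirstDiffLt rank S S'
  split-at-cut used-e i {u} {v} u∈ v∈ split cls = reduce do
    agree , P'≈ ← rounds-agree (suc i) inSig comparable
    ⊥-elim (split (proj₂ P'≈ u v (joined-in-σ agree)))
    where
      module Pinf = IsDecEquivalence (A.Pinf-isDecEquivalence i)
      u~v : Pinf S i u v
      u~v = class-related Pinf.isEquivalence cls (πe⊆X u∈) (πe⊆X v∈)
      inSig : InSig S (suc i)
      inSig = A.start-change⇒InSig i (λ P'≈ → split (proj₂ P'≈ u v u~v))
      comparable : ∀ i' → i' ℕ.< suc i → Comparable i'
      comparable i' i'<1+i = comparable-below-class Pinf.isEquivalence cls i' (A.Pinf-antitone (ℕP.≤-pred i'<1+i))
                               (λ d≡S → inSig i' i'<1+i (inj₁ d≡S))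
      joined-in-σ : AgreeBefore (suc i) → P S' (suc i) 0 u v
      joined-in-σ agree with A.row-start i
      ... | inj₁ P'≈ = ⊥-elim (split (proj₂ P'≈ u v u~v))
      ... | inj₂ (a , d≡a , inj₁ ((_ , antibridge) , _)) =
        σ-cut-joins i (λ { refl → xAntibridge-unused E antibridge used-e })
          (xAntibridge-unused E antibridge) (trans (sym (agree (i , dd) ℕP.≤-refl)) d≡a)
          u∈ v∈ (proj₁ (agree (i , p∞) ℕP.≤-refl) u v u~v)
      ... | inj₂ (a , d≡a , inj₂ ((w , bridge) , P'≈)) =
        ⊥-elim (split (proj₂ P'≈ u v (u~v , step e (here Pinf.refl) (∈-⊖⁺ π a e a≢e u∈) (∈-⊖⁺ π a e a≢e v∈) u~v)))
        where
          a≢e : a ≢ e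
          a≢e refl = ¬xBridge-e (class⇒withinClass Pinf.isEquivalence Pinf.isEquivalence cls ≤P-refl) w bridge

  never-split : IsClass (Pii S) X → ¬ QCyc E π (Pii S) → SigLe rank S S'
  never-split cls acyclic =
    [ inj₂ , (λ agree → inj₁ λ p inSig-p → agree p (s≤s (InSig⇒≤terminal {S = S} inSig-p term))) ]′ agreement
    where
      ℓ = proj₁ A.∃-first-terminal
      term = proj₁ (proj₂ A.∃-first-terminal)
      inSig = proj₂ (proj₂ A.∃-first-terminal)
      isEq = IsDecEquivalence.isEquivalence A.Pii-isDecEquivalence
      comparable : ∀ i → Comparable i
      comparable i = comparable-below-class isEq cls i (A.Pii-≤-Pinf i)
        (λ d≡S → acyclic (qCyc-resp E (≈P-sym (A.Pii≈terminal i (inj₁ d≡S))) (A.stop⇒cycle i d≡S)))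
      agreement : FirstDiffLt rank S S' ⊎ AgreeBefore (suc ℓ)
      agreement = do
        agree , P₀≈ ← rounds-agree ℓ inSig (λ i _ → comparable i)
        agree' , _ ← round-agrees ℓ agree inSig P₀≈ (comparable ℓ)
        pure agree'

lemma13 : ∀ {n m} (E : Fin m → Subset n) → Is3Hyp E →
    (rank : D m → ℕ) → DOrder rank →
    (π : QG n m) → IsQuasigraph E π →
    (S : Seq n m) → PlaneSeq E π S →
    (e : Fin m) → (S' : Seq n m) → PlaneSeq E (π ⊖ e) S' →
    (X : Subset n) →
    Used π e → π e ⊆ X → ConnOn (π ⊖ e) (_∈ X) →
    CondA π S e X ⊎ CondB E π S X →
    SigLe rank S S' × (CondA π S e X → SigLt rank S S')
lemma13 E _ rank dord π isQG S ps e S' ps' X used-e πe⊆X σ-conn cond =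
  [ proj₁ ∘ strict , (λ (cls , _ , acyclic) → never-split cls acyclic) ]′ cond , strict
  where
    open Comparison E π isQG e X πe⊆X σ-conn rank dord S S' ps ps'
    strict : CondA π S e X → SigLt rank S S'
    strict (inj₁ (i , j , u , v , (u∈ , v∈ , split) , cls)) = FirstDiffLt⇒SigLt rank (split-in-row i j u∈ v∈ split cls)
    strict (inj₂ (i , u , v , (u∈ , v∈ , split) , cls)) = FirstDiffLt⇒SigLt rank (split-at-cut used-e i u∈ v∈ split cls)
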